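{- Let $\varepsilon\in(0,1/2]$ and $t\in\mathbb{N}$. For every $0<\varepsilon'<\varepsilon$ there exists a constant $K=K(\varepsilon,\varepsilon')$ (depending only on $\varepsilon$ and $\varepsilon'$) such that every $\varepsilon$-balanced bicolored graph $G$ with sufficiently many vertices and with \[ e(G)\geq \left(1-\frac{1}{K\cdot R(\varepsilon',t)}\right)\binom{v(G)}{2} \] edges contains an unavoidable $t$-graph.
   Context: A bicolored graph is a simple graph whose edges are each colored red or blue. A bicolored graph $G$ is $\varepsilon$-balanced if each of the two color classes contains at least $\varepsilon\cdot e(G)$ edges. A bicolored graph $H$ is contained in $G$ (or $G$ contains a copy of $H$) if there is an injective map $V(H)\to V(G)$ sending every edge of $H$ to an edge of $G$ of the same color. An unavoidable $t$-graph is a bicolored complete graph $K_{2t}$ in which one of the two color classes is either a clique on $t$ vertices (Type 1) or the union of two vertex-disjoint cliques on $t$ vertices each (Type 2); all remaining edges have the other color. For $\varepsilon\in(0,1/2]$ and $t\in\mathbb{N}$, $R(\varepsilon,t)$ is the smallest integer such that for every $n\ge R(\varepsilon,t)$, every $\varepsilon$-balanced bicolored $K_n$ contains an unavoidable $t$-graph.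
   Formalization: The balance parameters ε and ε′ range over the rationals. -}

module Defs where

open import Data.Nat as ℕ using (ℕ; _<_)
open import Data.Nat.Combinatorics using (_C_)
open import Data.Fin using (Fin; toℕ)
open import Data.Bool using (Bool; true; false; if_then_else_; _∧_)
open import Data.Maybe using (Maybe; just; nothing; is-just)
open import Data.List using (List; map; allFin)
open import Data.Nat.ListAction using (sum)
open import Data.Integer using (+_)
open import Data.Rational as ℚ using (ℚ; 0ℚ; 1ℚ; _/_; _≤_; _*_; _-_; ≢-nonZero)
open import Data.Rational.Properties using (_≟_)
open import Data.Product using (Σ; _×_; ∃)
open import Data.Sum using (_⊎_)
open import Relation.Nullary using (yes; no; ¬_)
open import Relation.Nullary.Decidable using (⌊_⌋)
open import Relation.Binary.PropositionalEquality using (_≡_; _≢_)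
open import Function.Definitions using (Injective)

data Colour : Set where
  red blue : Colour

-- A bicoloured simple graph on vertex set Fin n:
-- col i j = nothing  means ij is not an edge, just c means an edge of colour c.
record BiGraph (n : ℕ) : Set where
  field
    col    : Fin n → Fin n → Maybe Colour
    symm   : ∀ i j → col i j ≡ col j i
    irrefl : ∀ i → col i i ≡ nothing
open BiGraph public

Complete : ∀ {n} → BiGraph n → Set
Complete {n} G = ∀ (i j : Fin n) → i ≢ j → is-just (col G i j) ≡ true

countPairs : ∀ {n} → (Fin n → Fin n → Bool) → ℕ
countPairs {n} P =
  sum (map (λ i → sum (map (λ j → if ⌊ toℕ i ℕ.<? toℕ j ⌋ then (if P i j then 1 else 0) else 0)
                           (allFin n)))
           (allFin n))

isColour : Colour → Maybe Colour → Bool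
isColour red  (just red)  = true
isColour blue (just blue) = true
isColour _    _           = false

e : ∀ {n} → BiGraph n → ℕ
e G = countPairs (λ i j → is-just (col G i j))

eCol : ∀ {n} → Colour → BiGraph n → ℕ
eCol c G = countPairs (λ i j → isColour c (col G i j))

toℚ : ℕ → ℚ
toℚ m = + m / 1

Balanced : ∀ {n} → ℚ → BiGraph n → Set
Balanced ε G = ((ε * toℚ (e G)) ≤ toℚ (eCol red G)) × ((ε * toℚ (e G)) ≤ toℚ (eCol blue G))

ContainsCol : ∀ {n m} → BiGraph n → (Fin m → Fin m → Maybe Colour) → Set
ContainsCol {n} {m} G h =
  Σ (Fin m → Fin n) λ f → Injective _≡_ _≡_ f ×
    (∀ i j → is-just (h i j) ≡ true → col G (f i) (f j) ≡ h i j)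

Contains : ∀ {n m} → BiGraph n → BiGraph m → Set
Contains G H = ContainsCol G (col H)

other : Colour → Colour
other red  = blue
other blue = red

data UType : Set where
  type1 type2 : UType

-- The unavoidable t-graph (a bicoloured K_{2t}) on Fin (t + t); the first t
-- vertices form the set A, the last t form B.  For colour c:
--  type1: the c-coloured edges are exactly the edges inside A (a K_t),
--         all other edges get colour (other c);
--  type2: the c-coloured edges are exactly the edges inside A and inside B
--         (two disjoint K_t's), edges between A and B get (other c).
-- Every unavoidable t-graph is isomorphic to one of these four.
inA : ∀ {t} → Fin (t ℕ.+ t) → Bool
inA {t} i = ⌊ toℕ i ℕ.<? t ⌋

sameSide : Bool → Bool → Bool
sameSide true  true  = true
sameSide false false = true
sameSide _     _     = false

uCol : ∀ t → UType → Colour → Fin (t ℕ.+ t) → Fin (t ℕ.+ t) → Maybe Colour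
uCol t τ c i j with ⌊ toℕ i ℕ.≟ toℕ j ⌋
... | true = nothing
... | false with τ
...   | type1 = just (if inA {t} i ∧ inA {t} j then c else other c)
...   | type2 = just (if sameSide (inA {t} i) (inA {t} j) then c else other c)

ContainsUnavoidable : ∀ {n} → ℕ → BiGraph n → Set
ContainsUnavoidable t G = Σ UType λ τ → Σ Colour λ c → ContainsCol G (uCol t τ c)

RamseyProp : ℚ → ℕ → ℕ → Set
RamseyProp ε t m = ∀ n → m ℕ.≤ n → (G : BiGraph n) → Complete G → Balanced ε G →
                   ContainsUnavoidable t G

IsR : ℚ → ℕ → ℕ → Set
IsR ε t R = RamseyProp ε t R × (∀ m → RamseyProp ε t m → R ℕ.≤ m)

-- total inverse on ℚ: inv p = 1/p for p ≠ 0 (inv 0 = 0, never used in the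
-- theorem since K > 0 and R(ε',t) > 0 whenever t ≥ 1).
inv : ℚ → ℚ
inv p with p ≟ 0ℚ
... | yes _ = 0ℚ
... | no p≢0 = ℚ.1/_ p {{≢-nonZero p≢0}}

threshold : ℚ → ℕ → ℕ → ℚ
threshold K R n = (1ℚ - inv (K * toℚ R)) * toℚ (n C 2)

-- Write ε = P/Q and ε′ = b/q.  When G misses at most a 1/(K R) fraction of the pairs,
-- averaging over all m-tuples of vertices (m ≈ c R) gives a tuple u with more than a b/q
-- share of red pairs and few non-edges, and then a tuple v with more than a b/q share of
-- blue pairs, few non-edges, and few non-edges towards u.  Replacing the entries of u by
-- those of v one at a time moves the red and blue pair counts by at most m per step, so
-- some intermediate tuple has at least a b/q share of both colours.  Greedily deleting
-- the entries involved in non-edges leaves a clique on at least R vertices which is still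
-- ε′-balanced, and so contains an unavoidable t-graph by the definition of R = R(ε′, t).

module Submission where

module FiniteSums where

  open import Data.Nat
  open import Data.Nat.Properties
  open import Data.Fin using (Fin; zero; suc)
  open import Data.List using (List; []; _∷_; map; allFin; length; tabulate)
  open import Data.Bool using (Bool; true; false)
  open import Data.Nat.ListAction using (sum)
  open import Data.Product using (Σ; _,_)
  open import Relation.Nullary using (yes; no; contradiction)
  open import Relation.Binary.PropositionalEquality
  open import Data.Nat.Tactic.RingSolver using (solve-∀)
  open import Algebra.Properties.Semiring.Sum +-*-semiring public
    using (sum-cong-≗; *-distribˡ-sum) renaming (sum to ∑)

  indicator : Bool → ℕ
  indicator true  = 1
  indicator false = 0

  indicator≤1 : ∀ b → indicator b ≤ 1
  indicator≤1 true  = ≤-refl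
  indicator≤1 false = z≤n

  sumMap : ∀ {a} {A : Set a} → (A → ℕ) → List A → ℕ
  sumMap f []       = 0
  sumMap f (x ∷ xs) = f x + sumMap f xs

  module _ {a} {A : Set a} where

    sumMap-cong : ∀ {f g : A → ℕ} xs → (∀ x → f x ≡ g x) → sumMap f xs ≡ sumMap g xs
    sumMap-cong []       f≗g = refl
    sumMap-cong (x ∷ xs) f≗g = cong₂ _+_ (f≗g x) (sumMap-cong xs f≗g)

    sumMap-mono : ∀ {f g : A → ℕ} xs → (∀ x → f x ≤ g x) → sumMap f xs ≤ sumMap g xs
    sumMap-mono []       f≤g = z≤n
    sumMap-mono (x ∷ xs) f≤g = +-mono-≤ (f≤g x) (sumMap-mono xs f≤g)

    sumMap-+ : ∀ (f g : A → ℕ) xs → sumMap (λ x → f x + g x) xs ≡ sumMap f xs + sumMap g xs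
    sumMap-+ f g []       = refl
    sumMap-+ f g (x ∷ xs) rewrite sumMap-+ f g xs = +-+-comm (f x) (g x) (sumMap f xs) (sumMap g xs)
      where
      +-+-comm : ∀ a b c d → (a + b) + (c + d) ≡ (a + c) + (b + d)
      +-+-comm = solve-∀

    sumMap-const : ∀ k (xs : List A) → sumMap (λ _ → k) xs ≡ k * length xs
    sumMap-const k []       = sym (*-zeroʳ k)
    sumMap-const k (x ∷ xs) rewrite sumMap-const k xs = sym (*-suc k (length xs))

    sumMap-≤-length : ∀ (f : A → ℕ) → (∀ x → f x ≤ 1) → ∀ xs → sumMap f xs ≤ length xs
    sumMap-≤-length f f≤1 []       = z≤n
    sumMap-≤-length f f≤1 (x ∷ xs) = +-mono-≤ (f≤1 x) (sumMap-≤-length f f≤1 xs)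

  sumMap-swap : ∀ {a b} {A : Set a} {B : Set b} (f : A → B → ℕ) xs ys →
                sumMap (λ x → sumMap (f x) ys) xs ≡ sumMap (λ y → sumMap (λ x → f x y) xs) ys
  sumMap-swap f []       ys = sym (sumMap-const 0 ys)
  sumMap-swap f (x ∷ xs) ys rewrite sumMap-swap f xs ys = sym (sumMap-+ (f x) (λ y → sumMap (λ x → f x y) xs) ys)

  sum-map≡sumMap : ∀ {a} {A : Set a} (f : A → ℕ) xs → sum (map f xs) ≡ sumMap f xs
  sum-map≡sumMap f []       = refl
  sum-map≡sumMap f (x ∷ xs) = cong (f x +_) (sum-map≡sumMap f xs)

  sumMap-tabulate : ∀ {a} {A : Set a} {n} (f : A → ℕ) (g : Fin n → A) → sumMap f (tabulate g) ≡ ∑ (λ i → f (g i))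
  sumMap-tabulate {n = zero}  f g = refl
  sumMap-tabulate {n = suc n} f g = cong (f (g zero) +_) (sumMap-tabulate f (λ i → g (suc i)))

  ∑-+ : ∀ {n} (f g : Fin n → ℕ) → ∑ (λ i → f i + g i) ≡ ∑ f + ∑ g
  ∑-+ {zero}  f g = refl
  ∑-+ {suc n} f g rewrite ∑-+ (λ i → f (suc i)) (λ i → g (suc i)) = +-+-comm (f zero) (g zero) _ _
    where
    +-+-comm : ∀ a b c d → (a + b) + (c + d) ≡ (a + c) + (b + d)
    +-+-comm = solve-∀

  ∑-const : ∀ {n} k → ∑ {n} (λ _ → k) ≡ k * n
  ∑-const {zero}  k = sym (*-zeroʳ k)
  ∑-const {suc n} k rewrite ∑-const {n} k = sym (*-suc k n)

  ∑-sumMap-swap : ∀ {a} {A : Set a} {n} (f : Fin n → A → ℕ) xs →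
                  ∑ (λ i → sumMap (f i) xs) ≡ sumMap (λ x → ∑ (λ i → f i x)) xs
  ∑-sumMap-swap {n = zero}  f xs = sym (sumMap-const 0 xs)
  ∑-sumMap-swap {n = suc n} f xs rewrite ∑-sumMap-swap (λ i → f (suc i)) xs =
    sym (sumMap-+ (f zero) (λ x → ∑ (λ i → f (suc i) x)) xs)

  ∑-≤-witness : ∀ {n} (f g : Fin (suc n) → ℕ) → ∑ f ≤ ∑ g → Σ (Fin (suc n)) λ i → f i ≤ g i
  ∑-≤-witness f g ∑f≤∑g with f zero ≤? g zero
  ∑-≤-witness f g ∑f≤∑g | yes f₀≤g₀ = zero , f₀≤g₀
  ∑-≤-witness {zero}  f g ∑f≤∑g | no f₀≰g₀ =
    contradiction (subst₂ _≤_ (+-identityʳ _) (+-identityʳ _) ∑f≤∑g) f₀≰g₀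
  ∑-≤-witness {suc n} f g ∑f≤∑g | no f₀≰g₀
    with ∑-≤-witness (λ i → f (suc i)) (λ i → g (suc i))
                     (+-cancelˡ-≤ (g zero) _ _ (≤-trans (+-monoˡ-≤ _ (<⇒≤ (≰⇒> f₀≰g₀))) ∑f≤∑g))
  ... | i , fᵢ≤gᵢ = suc i , fᵢ≤gᵢ

  ∑² : ∀ {n} → (Fin n → Fin n → ℕ) → ℕ
  ∑² W = ∑ (λ x → ∑ (W x))

  ∑²-+ : ∀ {n} (V W : Fin n → Fin n → ℕ) → ∑² (λ x y → V x y + W x y) ≡ ∑² V + ∑² W
  ∑²-+ V W = trans (sum-cong-≗ (λ x → ∑-+ (V x) (W x))) (∑-+ (λ x → ∑ (V x)) (λ x → ∑ (W x)))

  ∑²-allFin : ∀ {n} (W : Fin n → Fin n → ℕ) → ∑² W ≡ sumMap (λ x → sumMap (W x) (allFin n)) (allFin n)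
  ∑²-allFin {n} W = sym (trans (sumMap-tabulate (λ x → sumMap (W x) (allFin n)) (λ i → i))
                               (sum-cong-≗ (λ x → sumMap-tabulate (W x) (λ i → i))))

module TupleSums where

  open import Data.Nat
  open import Data.Nat.Properties
  open import Data.Nat.Combinatorics using (_C_; nCk+nC[k+1]≡[n+1]C[k+1]; nC1≡n)
  open import Data.Fin using (Fin; zero; suc)
  open import Data.List using (List; []; _∷_; length)
  open import Data.Product using (Σ; _×_; _,_)
  open import Relation.Binary.PropositionalEquality
  open import Data.Nat.Tactic.RingSolver using (solve-∀)
  open FiniteSums
  open ≡-Reasoning

  [1+m]C2≡m+mC2 : ∀ m → (suc m C 2) ≡ m + (m C 2)
  [1+m]C2≡m+mC2 m = sym (trans (cong (_+ m C 2) (sym (nC1≡n m))) (nCk+nC[k+1]≡[n+1]C[k+1] m 1))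

  2*[1+m]C2≡[1+m]*m : ∀ m → 2 * (suc m C 2) ≡ suc m * m
  2*[1+m]C2≡[1+m]*m zero    = refl
  2*[1+m]C2≡[1+m]*m (suc m) = begin
    2 * (suc (suc m) C 2)        ≡⟨ cong (2 *_) ([1+m]C2≡m+mC2 (suc m)) ⟩
    2 * (suc m + (suc m C 2))    ≡⟨ *-distribˡ-+ 2 (suc m) (suc m C 2) ⟩
    2 * suc m + 2 * (suc m C 2)  ≡⟨ cong (2 * suc m +_) (2*[1+m]C2≡[1+m]*m m) ⟩
    2 * suc m + suc m * m        ≡⟨ ring m ⟩
    suc (suc m) * suc m          ∎
    where
    ring : ∀ m → 2 * suc m + suc m * m ≡ suc (suc m) * suc m
    ring = solve-∀

  2*nC2≤n*n : ∀ n → 2 * (n C 2) ≤ n * n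
  2*nC2≤n*n zero    = z≤n
  2*nC2≤n*n (suc n) = subst (_≤ suc n * suc n) (sym (2*[1+m]C2≡[1+m]*m n)) (*-monoʳ-≤ (suc n) (n≤1+n n))

  module _ {a} {A : Set a} where

    pairSum : (A → A → ℕ) → List A → ℕ
    pairSum W []       = 0
    pairSum W (x ∷ xs) = sumMap (W x) xs + pairSum W xs

    pairSum-cong : ∀ {V W : A → A → ℕ} → (∀ x y → V x y ≡ W x y) → ∀ xs → pairSum V xs ≡ pairSum W xs
    pairSum-cong V≗W []       = refl
    pairSum-cong V≗W (x ∷ xs) = cong₂ _+_ (sumMap-cong xs (V≗W x)) (pairSum-cong V≗W xs)

    pairSum-mono : ∀ {V W : A → A → ℕ} → (∀ x y → V x y ≤ W x y) → ∀ xs → pairSum V xs ≤ pairSum W xs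
    pairSum-mono V≤W []       = z≤n
    pairSum-mono V≤W (x ∷ xs) = +-mono-≤ (sumMap-mono xs (V≤W x)) (pairSum-mono V≤W xs)

    pairSum-+ : ∀ (V W : A → A → ℕ) xs →
                pairSum (λ x y → V x y + W x y) xs ≡ pairSum V xs + pairSum W xs
    pairSum-+ V W []       = refl
    pairSum-+ V W (x ∷ xs) rewrite pairSum-+ V W xs | sumMap-+ (V x) (W x) xs =
      +-+-comm (sumMap (V x) xs) (sumMap (W x) xs) (pairSum V xs) (pairSum W xs)
      where
      +-+-comm : ∀ a b c d → a + b + (c + d) ≡ a + c + (b + d)
      +-+-comm = solve-∀

    pairSum-1 : ∀ xs → pairSum (λ _ _ → 1) xs ≡ (length xs C 2)
    pairSum-1 []       = refl
    pairSum-1 (x ∷ xs) = begin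
      sumMap (λ _ → 1) xs + pairSum (λ _ _ → 1) xs ≡⟨ cong₂ _+_ (trans (sumMap-const 1 xs) (*-identityˡ _)) (pairSum-1 xs) ⟩
      length xs + (length xs C 2)                  ≡⟨ sym ([1+m]C2≡m+mC2 (length xs)) ⟩
      (suc (length xs) C 2)                        ∎

    pairSum-≤-C2 : ∀ (W : A → A → ℕ) → (∀ x y → W x y ≤ 1) → ∀ xs → pairSum W xs ≤ (length xs C 2)
    pairSum-≤-C2 W W≤1 xs = subst (pairSum W xs ≤_) (pairSum-1 xs) (pairSum-mono W≤1 xs)

    crossSum : (A → A → ℕ) → List A → List A → ℕ
    crossSum W xs ys = sumMap (λ x → sumMap (W x) ys) xs

    crossSum-sym : ∀ W → (∀ x y → W x y ≡ W y x) → ∀ xs ys → crossSum W ys xs ≡ crossSum W xs ys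
    crossSum-sym W W-sym xs ys =
      trans (sumMap-swap W ys xs) (sumMap-cong xs (λ x → sumMap-cong ys (λ y → W-sym y x)))

    crossSum-self : ∀ W → (∀ x y → W x y ≡ W y x) → ∀ xs →
                    crossSum W xs xs ≡ 2 * pairSum W xs + sumMap (λ x → W x x) xs
    crossSum-self W W-sym []       = refl
    crossSum-self W W-sym (x ∷ xs) = begin
      W x x + sumMap (W x) xs + sumMap (λ u → W u x + sumMap (W u) xs) xs
        ≡⟨ cong (W x x + sumMap (W x) xs +_) (sumMap-+ (λ u → W u x) (λ u → sumMap (W u) xs) xs) ⟩
      W x x + sumMap (W x) xs + (sumMap (λ u → W u x) xs + crossSum W xs xs)
        ≡⟨ cong₂ (λ s c → W x x + sumMap (W x) xs + (s + c)) (sumMap-cong xs (λ u → W-sym u x)) (crossSum-self W W-sym xs) ⟩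
      W x x + sumMap (W x) xs + (sumMap (W x) xs + (2 * pairSum W xs + sumMap (λ u → W u u) xs))
        ≡⟨ ring (W x x) (sumMap (W x) xs) (pairSum W xs) (sumMap (λ u → W u u) xs) ⟩
      2 * (sumMap (W x) xs + pairSum W xs) + (W x x + sumMap (λ u → W u u) xs) ∎
      where
      ring : ∀ w s p d → w + s + (s + (2 * p + d)) ≡ 2 * (s + p) + (w + d)
      ring = solve-∀

  module _ {n : ℕ} where

    -- the n^m tuples in (Fin n)^m are represented as lists of length m
    ∑Tuples : ℕ → (List (Fin n) → ℕ) → ℕ
    ∑Tuples zero    F = F []
    ∑Tuples (suc m) F = ∑ (λ x → ∑Tuples m (λ xs → F (x ∷ xs)))

    ∑Tuples-cong : ∀ m {F G : List (Fin n) → ℕ} → (∀ xs → F xs ≡ G xs) → ∑Tuples m F ≡ ∑Tuples m G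
    ∑Tuples-cong zero    F≗G = F≗G []
    ∑Tuples-cong (suc m) F≗G = sum-cong-≗ (λ x → ∑Tuples-cong m (λ xs → F≗G (x ∷ xs)))

    ∑Tuples-+ : ∀ m (F G : List (Fin n) → ℕ) → ∑Tuples m (λ xs → F xs + G xs) ≡ ∑Tuples m F + ∑Tuples m G
    ∑Tuples-+ zero    F G = refl
    ∑Tuples-+ (suc m) F G = trans (sum-cong-≗ (λ x → ∑Tuples-+ m (λ xs → F (x ∷ xs)) (λ xs → G (x ∷ xs))))
                                  (∑-+ (λ x → ∑Tuples m (λ xs → F (x ∷ xs))) (λ x → ∑Tuples m (λ xs → G (x ∷ xs))))

    ∑Tuples-* : ∀ m k (F : List (Fin n) → ℕ) → ∑Tuples m (λ xs → k * F xs) ≡ k * ∑Tuples m F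
    ∑Tuples-* zero    k F = refl
    ∑Tuples-* (suc m) k F = trans (sum-cong-≗ (λ x → ∑Tuples-* m k (λ xs → F (x ∷ xs))))
                                  (sym (*-distribˡ-sum k (λ x → ∑Tuples m (λ xs → F (x ∷ xs)))))

    ∑Tuples-const : ∀ m k → ∑Tuples m (λ _ → k) ≡ k * n ^ m
    ∑Tuples-const zero    k = sym (*-identityʳ k)
    ∑Tuples-const (suc m) k = begin
      ∑ {n} (λ _ → ∑Tuples m (λ _ → k)) ≡⟨ sum-cong-≗ {n} (λ _ → ∑Tuples-const m k) ⟩
      ∑ {n} (λ _ → k * n ^ m)           ≡⟨ ∑-const (k * n ^ m) ⟩
      k * n ^ m * n                     ≡⟨ ring k (n ^ m) n ⟩
      k * (n * n ^ m)                   ∎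
      where
      ring : ∀ a b c → a * b * c ≡ a * (c * b)
      ring = solve-∀

    -- each of the m coordinates of a uniformly random tuple is uniform on Fin n
    ∑Tuples-sumMap : ∀ m (g : Fin n → ℕ) → n * ∑Tuples m (sumMap g) ≡ m * n ^ m * ∑ g
    ∑Tuples-sumMap zero    g = *-zeroʳ n
    ∑Tuples-sumMap (suc m) g = begin
      n * ∑ (λ x → ∑Tuples m (λ ys → g x + sumMap g ys))
        ≡⟨ cong (n *_) (sum-cong-≗ (λ x → ∑Tuples-+ m (λ _ → g x) (sumMap g))) ⟩
      n * ∑ (λ x → ∑Tuples m (λ _ → g x) + ∑Tuples m (sumMap g))
        ≡⟨ cong (n *_) (∑-+ (λ x → ∑Tuples m (λ _ → g x)) (λ _ → ∑Tuples m (sumMap g))) ⟩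
      n * (∑ (λ x → ∑Tuples m (λ _ → g x)) + ∑ {n} (λ _ → ∑Tuples m (sumMap g)))
        ≡⟨ cong₂ (λ u v → n * (u + v)) (sum-cong-≗ (λ x → trans (∑Tuples-const m (g x)) (*-comm (g x) (n ^ m))))
                                       (∑-const (∑Tuples m (sumMap g))) ⟩
      n * (∑ (λ x → n ^ m * g x) + ∑Tuples m (sumMap g) * n)
        ≡⟨ cong (λ u → n * (u + ∑Tuples m (sumMap g) * n)) (sym (*-distribˡ-sum (n ^ m) g)) ⟩
      n * (n ^ m * ∑ g + ∑Tuples m (sumMap g) * n)
        ≡⟨ ring₁ n (n ^ m) (∑ g) (∑Tuples m (sumMap g)) ⟩
      n * n ^ m * ∑ g + n * ∑Tuples m (sumMap g) * n
        ≡⟨ cong (λ u → n * n ^ m * ∑ g + u * n) (∑Tuples-sumMap m g) ⟩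
      n * n ^ m * ∑ g + m * n ^ m * ∑ g * n
        ≡⟨ ring₂ n (n ^ m) (∑ g) m ⟩
      suc m * (n * n ^ m) * ∑ g ∎
      where
      ring₁ : ∀ a b c d → a * (b * c + d * a) ≡ a * b * c + a * d * a
      ring₁ = solve-∀
      ring₂ : ∀ a b c m → a * b * c + m * b * c * a ≡ suc m * (a * b) * c
      ring₂ = solve-∀

    -- each of the (m choose 2) coordinate pairs of a uniformly random tuple is uniform on Fin n × Fin n
    ∑Tuples-pairSum : ∀ m (W : Fin n → Fin n → ℕ) →
                      n * n * ∑Tuples m (pairSum W) ≡ (m C 2) * n ^ m * ∑² W
    ∑Tuples-pairSum zero    W = *-zeroʳ (n * n)
    ∑Tuples-pairSum (suc m) W = begin
      n * n * ∑ (λ x → ∑Tuples m (λ ys → sumMap (W x) ys + pairSum W ys))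
        ≡⟨ cong (n * n *_) (sum-cong-≗ (λ x → ∑Tuples-+ m (sumMap (W x)) (pairSum W))) ⟩
      n * n * ∑ (λ x → ∑Tuples m (sumMap (W x)) + ∑Tuples m (pairSum W))
        ≡⟨ cong (n * n *_) (∑-+ (λ x → ∑Tuples m (sumMap (W x))) (λ _ → ∑Tuples m (pairSum W))) ⟩
      n * n * (∑ (λ x → ∑Tuples m (sumMap (W x))) + ∑ {n} (λ _ → ∑Tuples m (pairSum W)))
        ≡⟨ cong (λ u → n * n * (∑ (λ x → ∑Tuples m (sumMap (W x))) + u)) (∑-const (∑Tuples m (pairSum W))) ⟩
      n * n * (∑ (λ x → ∑Tuples m (sumMap (W x))) + ∑Tuples m (pairSum W) * n)
        ≡⟨ ring₁ n (∑ (λ x → ∑Tuples m (sumMap (W x)))) (∑Tuples m (pairSum W)) ⟩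
      n * (n * ∑ (λ x → ∑Tuples m (sumMap (W x)))) + n * n * ∑Tuples m (pairSum W) * n
        ≡⟨ cong₂ (λ u v → n * u + v * n) (*-distribˡ-sum n (λ x → ∑Tuples m (sumMap (W x)))) (∑Tuples-pairSum m W) ⟩
      n * ∑ (λ x → n * ∑Tuples m (sumMap (W x))) + (m C 2) * n ^ m * S * n
        ≡⟨ cong (λ u → n * u + (m C 2) * n ^ m * S * n) (sum-cong-≗ (λ x → ∑Tuples-sumMap m (W x))) ⟩
      n * ∑ (λ x → m * n ^ m * ∑ (W x)) + (m C 2) * n ^ m * S * n
        ≡⟨ cong (λ u → n * u + (m C 2) * n ^ m * S * n) (sym (*-distribˡ-sum (m * n ^ m) (λ x → ∑ (W x)))) ⟩
      n * (m * n ^ m * S) + (m C 2) * n ^ m * S * n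
        ≡⟨ ring₂ n m (n ^ m) S (m C 2) ⟩
      (m + m C 2) * (n * n ^ m) * S
        ≡⟨ cong (λ u → u * (n * n ^ m) * S) (sym ([1+m]C2≡m+mC2 m)) ⟩
      (suc m C 2) * (n * n ^ m) * S ∎
      where
      S : ℕ
      S = ∑² W
      ring₁ : ∀ a b c → a * a * (b + c * a) ≡ a * (a * b) + a * a * c * a
      ring₁ = solve-∀
      ring₂ : ∀ a m b c t → a * (m * b * c) + t * b * c * a ≡ (m + t) * (a * b) * c
      ring₂ = solve-∀

  ∑Tuples-≤-witness : ∀ {n} m (F G : List (Fin (suc n)) → ℕ) → ∑Tuples m F ≤ ∑Tuples m G →
                      Σ (List (Fin (suc n))) λ xs → length xs ≡ m × F xs ≤ G xs
  ∑Tuples-≤-witness zero    F G F≤G = [] , refl , F≤G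
  ∑Tuples-≤-witness (suc m) F G ∑F≤∑G with ∑-≤-witness _ _ ∑F≤∑G
  ... | x , ∑Fx≤∑Gx with ∑Tuples-≤-witness m (λ xs → F (x ∷ xs)) (λ xs → G (x ∷ xs)) ∑Fx≤∑Gx
  ...   | xs , refl , Fxxs≤Gxxs = x ∷ xs , refl , Fxxs≤Gxxs

module GreedyCliques where

  open import Data.Nat
  open import Data.Nat.Properties
  open import Data.Bool using (Bool; true; false; not) renaming (_≟_ to _≟ᵇ_)
  open import Data.List using (List; []; _∷_; length)
  open import Data.List.Relation.Unary.All using (All; []; _∷_; all?)
  open import Data.List.Relation.Unary.AllPairs using (AllPairs; []; _∷_)
  open import Relation.Nullary using (yes; no; ¬_; contradiction)
  open import Relation.Binary.PropositionalEquality
  open import Data.Nat.Tactic.RingSolver using (solve-∀)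
  open FiniteSums
  open TupleSums using (pairSum)
  open ≤-Reasoning

  module GreedyClique {a} {A : Set a} (adj : A → A → Bool) where

    nonAdj : A → A → ℕ
    nonAdj x y = indicator (not (adj x y))

    Adj : A → A → Set
    Adj x y = adj x y ≡ true

    greedyClique : List A → List A
    greedyClique []       = []
    greedyClique (x ∷ xs) with all? (λ y → adj x y ≟ᵇ true) (greedyClique xs)
    ... | yes _ = x ∷ greedyClique xs
    ... | no  _ = greedyClique xs

    -- number of non-adjacent pairs (including repeated entries)
    defects : List A → ℕ
    defects = pairSum nonAdj

    greedyClique-clique : ∀ xs → AllPairs Adj (greedyClique xs)
    greedyClique-clique []       = []
    greedyClique-clique (x ∷ xs) with all? (λ y → adj x y ≟ᵇ true) (greedyClique xs)
    ... | yes x~ys = x~ys ∷ greedyClique-clique xs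
    ... | no  _    = greedyClique-clique xs

    ¬All⇒1≤nonAdj : ∀ x ys → ¬ All (Adj x) ys → 1 ≤ sumMap (nonAdj x) ys
    ¬All⇒1≤nonAdj x []       ¬x~ys = contradiction [] ¬x~ys
    ¬All⇒1≤nonAdj x (y ∷ ys) ¬x~ys with adj x y in xy
    ... | false = s≤s z≤n
    ... | true  = ≤-trans (¬All⇒1≤nonAdj x ys (λ x~ys → ¬x~ys (xy ∷ x~ys))) (m≤n+m _ 0)

    sumMap-greedyClique-≤ : ∀ (g : A → ℕ) xs → sumMap g (greedyClique xs) ≤ sumMap g xs
    sumMap-greedyClique-≤ g []       = z≤n
    sumMap-greedyClique-≤ g (x ∷ xs) with all? (λ y → adj x y ≟ᵇ true) (greedyClique xs)
    ... | yes _ = +-monoʳ-≤ (g x) (sumMap-greedyClique-≤ g xs)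
    ... | no  _ = ≤-trans (sumMap-greedyClique-≤ g xs) (m≤n+m _ _)

    pairSum-greedyClique-≤ : ∀ (W : A → A → ℕ) xs → pairSum W (greedyClique xs) ≤ pairSum W xs
    pairSum-greedyClique-≤ W []       = z≤n
    pairSum-greedyClique-≤ W (x ∷ xs) with all? (λ y → adj x y ≟ᵇ true) (greedyClique xs)
    ... | yes _ = +-mono-≤ (sumMap-greedyClique-≤ (W x) xs) (pairSum-greedyClique-≤ W xs)
    ... | no  _ = ≤-trans (pairSum-greedyClique-≤ W xs) (m≤n+m _ _)

    defects-dropped : ∀ x xs → ¬ All (Adj x) (greedyClique xs) → suc (defects xs) ≤ defects (x ∷ xs)
    defects-dropped x xs ¬x~ys =
      +-monoˡ-≤ (defects xs) (≤-trans (¬All⇒1≤nonAdj x (greedyClique xs) ¬x~ys) (sumMap-greedyClique-≤ (nonAdj x) xs))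

    sumMap-≤-greedyClique : ∀ (g : A → ℕ) → (∀ x → g x ≤ 1) → ∀ xs →
                            sumMap g xs ≤ sumMap g (greedyClique xs) + defects xs
    sumMap-≤-greedyClique g g≤1 []       = z≤n
    sumMap-≤-greedyClique g g≤1 (x ∷ xs) with all? (λ y → adj x y ≟ᵇ true) (greedyClique xs)
    ... | yes _ = begin
      g x + sumMap g xs                                 ≤⟨ +-monoʳ-≤ (g x) (sumMap-≤-greedyClique g g≤1 xs) ⟩
      g x + (sumMap g (greedyClique xs) + defects xs)   ≡⟨ sym (+-assoc (g x) _ _) ⟩
      g x + sumMap g (greedyClique xs) + defects xs     ≤⟨ +-monoʳ-≤ (g x + _) (m≤n+m (defects xs) _) ⟩
      g x + sumMap g (greedyClique xs) + defects (x ∷ xs) ∎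
    ... | no ¬x~ys = begin
      g x + sumMap g xs                                 ≤⟨ +-mono-≤ (g≤1 x) (sumMap-≤-greedyClique g g≤1 xs) ⟩
      1 + (sumMap g (greedyClique xs) + defects xs)     ≡⟨ sym (+-suc (sumMap g (greedyClique xs)) _) ⟩
      sumMap g (greedyClique xs) + suc (defects xs)     ≤⟨ +-monoʳ-≤ _ (defects-dropped x xs ¬x~ys) ⟩
      sumMap g (greedyClique xs) + defects (x ∷ xs)     ∎

    length-≤-greedyClique : ∀ xs → length xs ≤ length (greedyClique xs) + defects xs
    length-≤-greedyClique xs =
      subst₂ (λ l l′ → l ≤ l′ + defects xs) (count xs) (count (greedyClique xs))
             (sumMap-≤-greedyClique (λ _ → 1) (λ _ → ≤-refl) xs)
      where
      count : ∀ ys → sumMap (λ _ → 1) ys ≡ length ys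
      count []       = refl
      count (y ∷ ys) = cong suc (count ys)

    -- deleting one entry destroys at most |xs| pairs, and entries are deleted only against defects
    pairSum-≤-greedyClique : ∀ (W : A → A → ℕ) → (∀ x y → W x y ≤ 1) → ∀ xs →
                             pairSum W xs ≤ pairSum W (greedyClique xs) + length xs * defects xs
    pairSum-≤-greedyClique W W≤1 []       = z≤n
    pairSum-≤-greedyClique W W≤1 (x ∷ xs) with all? (λ y → adj x y ≟ᵇ true) (greedyClique xs)
    ... | yes _ = begin
      sumMap (W x) xs + pairSum W xs
        ≤⟨ +-mono-≤ (sumMap-≤-greedyClique (W x) (W≤1 x) xs) (pairSum-≤-greedyClique W W≤1 xs) ⟩
      (sumMap (W x) ys + defects xs) + (pairSum W ys + length xs * defects xs)
        ≡⟨ ring (sumMap (W x) ys) (defects xs) (pairSum W ys) (length xs) ⟩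
      (sumMap (W x) ys + pairSum W ys) + suc (length xs) * defects xs
        ≤⟨ +-monoʳ-≤ (sumMap (W x) ys + pairSum W ys) (*-monoʳ-≤ (suc (length xs)) (m≤n+m (defects xs) (sumMap (nonAdj x) xs))) ⟩
      (sumMap (W x) ys + pairSum W ys) + suc (length xs) * defects (x ∷ xs) ∎
      where
      ys : List A
      ys = greedyClique xs
      ring : ∀ s d p l → (s + d) + (p + l * d) ≡ (s + p) + suc l * d
      ring = solve-∀
    ... | no ¬x~ys = begin
      sumMap (W x) xs + pairSum W xs
        ≤⟨ +-mono-≤ (sumMap-≤-length (W x) (W≤1 x) xs) (pairSum-≤-greedyClique W W≤1 xs) ⟩
      length xs + (pairSum W ys + length xs * defects xs)
        ≤⟨ slack (length xs) (pairSum W ys) (defects xs) ⟩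
      pairSum W ys + suc (length xs) * suc (defects xs)
        ≤⟨ +-monoʳ-≤ (pairSum W ys) (*-monoʳ-≤ (suc (length xs)) (defects-dropped x xs ¬x~ys)) ⟩
      pairSum W ys + suc (length xs) * defects (x ∷ xs) ∎
      where
      ys : List A
      ys = greedyClique xs
      slack : ∀ l p d → l + (p + l * d) ≤ p + suc l * suc d
      slack l p d = subst (l + (p + l * d) ≤_) (ring l p d) (m≤m+n _ (suc d))
        where
        ring : ∀ l p d → l + (p + l * d) + suc d ≡ p + suc l * suc d
        ring = solve-∀

module Hybrids where

  open import Data.Nat
  open import Data.Nat.Properties
  open import Data.List using (List; []; _∷_; length)
  open import Relation.Binary.PropositionalEquality
  open import Data.Nat.Tactic.RingSolver using (solve-∀)
  open FiniteSums
  open TupleSums using (pairSum; crossSum)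
  open ≤-Reasoning

  module _ {a} {A : Set a} where

    hybrid : ℕ → List A → List A → List A
    hybrid zero    xs       ys       = xs
    hybrid (suc k) []       ys       = []
    hybrid (suc k) (x ∷ xs) []       = x ∷ xs
    hybrid (suc k) (x ∷ xs) (y ∷ ys) = y ∷ hybrid k xs ys

    length-hybrid : ∀ k xs ys → length (hybrid k xs ys) ≡ length xs
    length-hybrid zero    xs       ys       = refl
    length-hybrid (suc k) []       ys       = refl
    length-hybrid (suc k) (x ∷ xs) []       = refl
    length-hybrid (suc k) (x ∷ xs) (y ∷ ys) = cong suc (length-hybrid k xs ys)

    hybrid-length : ∀ xs ys → length xs ≡ length ys → hybrid (length xs) xs ys ≡ ys
    hybrid-length []       []       _     = refl
    hybrid-length (x ∷ xs) (y ∷ ys) |x|≡|y| = cong (y ∷_) (hybrid-length xs ys (suc-injective |x|≡|y|))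

    data Differ₁ : List A → List A → Set a where
      []    : Differ₁ [] []
      here  : ∀ x y zs → Differ₁ (x ∷ zs) (y ∷ zs)
      there : ∀ z {xs ys} → Differ₁ xs ys → Differ₁ (z ∷ xs) (z ∷ ys)

    Differ₁-refl : ∀ xs → Differ₁ xs xs
    Differ₁-refl []       = []
    Differ₁-refl (x ∷ xs) = here x x xs

    Differ₁-sym : ∀ {xs ys} → Differ₁ xs ys → Differ₁ ys xs
    Differ₁-sym []          = []
    Differ₁-sym (here x y zs) = here y x zs
    Differ₁-sym (there z d) = there z (Differ₁-sym d)

    hybrid-step : ∀ k xs ys → Differ₁ (hybrid k xs ys) (hybrid (suc k) xs ys)
    hybrid-step zero    []       ys       = []
    hybrid-step zero    (x ∷ xs) []       = Differ₁-refl (x ∷ xs)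
    hybrid-step zero    (x ∷ xs) (y ∷ ys) = here x y xs
    hybrid-step (suc k) []       ys       = []
    hybrid-step (suc k) (x ∷ xs) []       = Differ₁-refl (x ∷ xs)
    hybrid-step (suc k) (x ∷ xs) (y ∷ ys) = there y (hybrid-step k xs ys)

    sumMap-Differ₁ : ∀ (g : A → ℕ) → (∀ x → g x ≤ 1) → ∀ {xs ys} → Differ₁ xs ys →
                     sumMap g xs ≤ sumMap g ys + 1
    sumMap-Differ₁ g g≤1 []            = z≤n
    sumMap-Differ₁ g g≤1 (here x y zs) = begin
      g x + sumMap g zs       ≤⟨ +-monoˡ-≤ (sumMap g zs) (≤-trans (g≤1 x) (m≤n+m 1 (g y))) ⟩
      g y + 1 + sumMap g zs   ≡⟨ +-right-comm (g y) 1 (sumMap g zs) ⟩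
      g y + sumMap g zs + 1   ∎
      where
      +-right-comm : ∀ a b c → a + b + c ≡ a + c + b
      +-right-comm = solve-∀
    sumMap-Differ₁ g g≤1 (there z {xs} {ys} d) = begin
      g z + sumMap g xs       ≤⟨ +-monoʳ-≤ (g z) (sumMap-Differ₁ g g≤1 d) ⟩
      g z + (sumMap g ys + 1) ≡⟨ sym (+-assoc (g z) (sumMap g ys) 1) ⟩
      g z + sumMap g ys + 1   ∎

    pairSum-Differ₁ : ∀ (W : A → A → ℕ) → (∀ x y → W x y ≤ 1) → ∀ {xs ys} → Differ₁ xs ys →
                      pairSum W xs ≤ pairSum W ys + length ys
    pairSum-Differ₁ W W≤1 []            = z≤n
    pairSum-Differ₁ W W≤1 (here x y zs) = begin
      sumMap (W x) zs + pairSum W zs                       ≤⟨ +-monoˡ-≤ _ (sumMap-≤-length (W x) (W≤1 x) zs) ⟩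
      length zs + pairSum W zs                             ≤⟨ +-monoˡ-≤ _ (m≤n+m (length zs) (suc (sumMap (W y) zs))) ⟩
      suc (sumMap (W y) zs) + length zs + pairSum W zs     ≡⟨ ring (sumMap (W y) zs) (length zs) (pairSum W zs) ⟩
      sumMap (W y) zs + pairSum W zs + suc (length zs)     ∎
      where
      ring : ∀ s l p → suc s + l + p ≡ s + p + suc l
      ring = solve-∀
    pairSum-Differ₁ W W≤1 (there z {xs} {ys} d) = begin
      sumMap (W z) xs + pairSum W xs
        ≤⟨ +-mono-≤ (sumMap-Differ₁ (W z) (W≤1 z) d) (pairSum-Differ₁ W W≤1 d) ⟩
      (sumMap (W z) ys + 1) + (pairSum W ys + length ys)
        ≡⟨ ring (sumMap (W z) ys) (pairSum W ys) (length ys) ⟩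
      sumMap (W z) ys + pairSum W ys + suc (length ys) ∎
      where
      ring : ∀ s p l → (s + 1) + (p + l) ≡ s + p + suc l
      ring = solve-∀

    -- a hybrid only contains pairs from xs, from ys, or from xs × ys
    pairSum-hybrid-≤ : ∀ (W : A → A → ℕ) k xs ys →
                       pairSum W (hybrid k xs ys) ≤ pairSum W xs + pairSum W ys + crossSum W xs ys + crossSum W ys xs
    pairSum-hybrid-≤ W zero    xs       ys       = ≤-trans (m≤m+n _ _) (≤-trans (m≤m+n _ _) (m≤m+n _ _))
    pairSum-hybrid-≤ W (suc k) []       ys       = z≤n
    pairSum-hybrid-≤ W (suc k) (x ∷ xs) []       = ≤-trans (m≤m+n _ _) (≤-trans (m≤m+n _ _) (m≤m+n _ _))
    pairSum-hybrid-≤ W (suc k) (x ∷ xs) (y ∷ ys) = begin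
      sumMap (W y) h + pairSum W h
        ≤⟨ +-mono-≤ (sumMap-hybrid-≤ k xs ys) (pairSum-hybrid-≤ W k xs ys) ⟩
      (sumMap (W y) xs + sumMap (W y) ys) + (pairSum W xs + pairSum W ys + crossSum W xs ys + crossSum W ys xs)
        ≤⟨ +-mono-≤ (≤-refl {sumMap (W y) xs + sumMap (W y) ys})
                    (+-mono-≤ (+-monoʳ-≤ (pairSum W xs + pairSum W ys) (crossSum-∷ W xs ys y)) (crossSum-∷ W ys xs x)) ⟩
      (sumMap (W y) xs + sumMap (W y) ys) + (pairSum W xs + pairSum W ys + crossSum W xs (y ∷ ys) + crossSum W ys (x ∷ xs))
        ≤⟨ rearrange (W x y) (W y x) (sumMap (W x) xs) (sumMap (W y) xs) (sumMap (W y) ys) (sumMap (W x) ys)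
                     (pairSum W xs) (pairSum W ys) (crossSum W xs (y ∷ ys)) (crossSum W ys (x ∷ xs)) ⟩
      (sumMap (W x) xs + pairSum W xs) + (sumMap (W y) ys + pairSum W ys)
        + (W x y + sumMap (W x) ys + crossSum W xs (y ∷ ys)) + (W y x + sumMap (W y) xs + crossSum W ys (x ∷ xs)) ∎
      where
      h : List A
      h = hybrid k xs ys
      sumMap-hybrid-≤ : ∀ k xs ys → sumMap (W y) (hybrid k xs ys) ≤ sumMap (W y) xs + sumMap (W y) ys
      sumMap-hybrid-≤ zero    xs       ys       = m≤m+n _ _
      sumMap-hybrid-≤ (suc k) []       ys       = z≤n
      sumMap-hybrid-≤ (suc k) (x ∷ xs) []       = m≤m+n _ _
      sumMap-hybrid-≤ (suc k) (x ∷ xs) (y' ∷ ys) = begin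
        W y y' + sumMap (W y) (hybrid k xs ys)      ≤⟨ +-monoʳ-≤ (W y y') (sumMap-hybrid-≤ k xs ys) ⟩
        W y y' + (sumMap (W y) xs + sumMap (W y) ys) ≤⟨ ring≤ (W y x) (W y y') (sumMap (W y) xs) (sumMap (W y) ys) ⟩
        W y x + sumMap (W y) xs + (W y y' + sumMap (W y) ys) ∎
        where
        ring≤ : ∀ a b c d → b + (c + d) ≤ a + c + (b + d)
        ring≤ a b c d = subst (b + (c + d) ≤_) (ring a b c d) (m≤n+m _ a)
          where
          ring : ∀ a b c d → a + (b + (c + d)) ≡ a + c + (b + d)
          ring = solve-∀
      crossSum-∷ : ∀ W us vs z → crossSum W us vs ≤ crossSum W us (z ∷ vs)
      crossSum-∷ W us vs z = sumMap-mono us (λ u → m≤n+m _ (W u z))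
      rearrange : ∀ w w′ sx sy₁ sy sx′ p p′ c c′ →
                  (sy₁ + sy) + (p + p′ + c + c′) ≤ (sx + p) + (sy + p′) + (w + sx′ + c) + (w′ + sy₁ + c′)
      rearrange w w′ sx sy₁ sy sx′ p p′ c c′ =
        subst ((sy₁ + sy) + (p + p′ + c + c′) ≤_) (ring w w′ sx sy₁ sy sx′ p p′ c c′) (m≤m+n _ (w + w′ + sx + sx′))
        where
        ring : ∀ w w′ sx sy₁ sy sx′ p p′ c c′ →
               (sy₁ + sy) + (p + p′ + c + c′) + (w + w′ + sx + sx′)
               ≡ (sx + p) + (sy + p′) + (w + sx′ + c) + (w′ + sy₁ + c′)
        ring = solve-∀

module IntermediateValue where

  open import Data.Nat
  open import Data.Nat.Properties
  open import Data.Product using (Σ; _×_; _,_)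
  open import Relation.Nullary using (yes; no; ¬_; contradiction)
  open import Relation.Binary.PropositionalEquality
  open import Data.Nat.Tactic.RingSolver using (solve-∀)
  open ≤-Reasoning

  -- A discrete intermediate value argument for two counts ρ k, β k (k ≤ m) that
  -- move by at most L per step and whose sum stays within Δ of T.
  module Crossing (b e L Δ T m : ℕ) (ρ β : ℕ → ℕ)
    (ρ-step : ∀ k → k < m → ρ k ≤ ρ (suc k) + L)
    (β-step : ∀ k → k < m → β (suc k) ≤ β k + L)
    (ρ+β-large : ∀ k → k ≤ m → T ≤ ρ k + β k + Δ)
    (T-large : Δ + b * L + (b + suc e) * L + 2 * ((b + suc e) * L * Δ) ≤ T) where

    a : ℕ
    a = b + suc e

    RedHeavy BlueHeavy : ℕ → Set
    RedHeavy  k = b * β k + a * L * Δ ≤ a * ρ k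
    BlueHeavy k = b * ρ k + a * L * Δ ≤ a * β k

    -- otherwise adding the two failed inequalities gives (a - b)(ρ k + β k) < bL + aL + 2aLΔ,
    -- contradicting ρ+β-large and T-large
    ¬RedHeavy⇒BlueHeavy : ∀ k → k < m → ¬ RedHeavy (suc k) → BlueHeavy k
    ¬RedHeavy⇒BlueHeavy k k<m ¬red with b * ρ k + a * L * Δ ≤? a * β k
    ... | yes blue = blue
    ... | no ¬blue = contradiction T-large (<⇒≱ T<bound)
      where
      s X Y : ℕ
      s = ρ k + β k
      X = b * L + a * L * Δ + a * L
      Y = a * L * Δ
      red-bound : a * ρ k ≤ b * β k + X
      red-bound = begin
        a * ρ k                          ≤⟨ *-monoʳ-≤ a (ρ-step k k<m) ⟩
        a * (ρ (suc k) + L)              ≡⟨ *-distribˡ-+ a (ρ (suc k)) L ⟩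
        a * ρ (suc k) + a * L            ≤⟨ +-monoˡ-≤ (a * L) (<⇒≤ (≰⇒> ¬red)) ⟩
        b * β (suc k) + Y + a * L        ≤⟨ +-monoˡ-≤ (a * L) (+-monoˡ-≤ Y (*-monoʳ-≤ b (β-step k k<m))) ⟩
        b * (β k + L) + Y + a * L        ≡⟨ ring b (β k) L Y (a * L) ⟩
        b * β k + X                      ∎
        where
        ring : ∀ b β L u v → b * (β + L) + u + v ≡ b * β + (b * L + u + v)
        ring = solve-∀
      blue-bound : a * β k + 1 ≤ b * ρ k + Y
      blue-bound = subst (_≤ b * ρ k + Y) (+-comm 1 (a * β k)) (≰⇒> ¬blue)
      sum-bound : b * s + (suc e * s + 1) ≤ b * s + (X + Y)
      sum-bound = subst₂ _≤_ (ring₁ b (suc e) (ρ k) (β k)) (ring₂ b (ρ k) (β k) X Y) (+-mono-≤ red-bound blue-bound)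
        where
        ring₁ : ∀ b E ρ β → (b + E) * ρ + ((b + E) * β + 1) ≡ b * (ρ + β) + (E * (ρ + β) + 1)
        ring₁ = solve-∀
        ring₂ : ∀ b ρ β X Y → b * β + X + (b * ρ + Y) ≡ b * (ρ + β) + (X + Y)
        ring₂ = solve-∀
      s<X+Y : s < X + Y
      s<X+Y = ≤-trans (s≤s (m≤n*m s (suc e)))
                      (subst (_≤ X + Y) (+-comm (suc e * s) 1) (+-cancelˡ-≤ (b * s) _ _ sum-bound))
      T<bound : T < Δ + b * L + a * L + 2 * (a * L * Δ)
      T<bound = begin-strict
        T          ≤⟨ ρ+β-large k (<⇒≤ k<m) ⟩
        s + Δ      <⟨ +-monoˡ-< Δ s<X+Y ⟩
        X + Y + Δ  ≡⟨ ring (b * L) (a * L * Δ) (a * L) Δ ⟩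
        Δ + b * L + a * L + 2 * (a * L * Δ) ∎
        where
        ring : ∀ p q r d → p + q + r + q + d ≡ d + p + r + 2 * q
        ring = solve-∀

    balanced-point : RedHeavy 0 → BlueHeavy m → Σ ℕ λ k → RedHeavy k × BlueHeavy k
    balanced-point = go m 0 refl
      where
      go : ∀ j k → k + j ≡ m → RedHeavy k → BlueHeavy m → Σ ℕ λ k → RedHeavy k × BlueHeavy k
      go zero    k k+0≡m red blue = k , red , subst BlueHeavy (trans (sym k+0≡m) (+-identityʳ k)) blue
      go (suc j) k k+j≡m red blue with b * β (suc k) + a * L * Δ ≤? a * ρ (suc k)
      ... | yes red′ = go j (suc k) (trans (sym (+-suc k j)) k+j≡m) red′ blue
      ... | no ¬red′ = k , red , ¬RedHeavy⇒BlueHeavy k k<m ¬red′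
        where
        k<m : k < m
        k<m = subst (k <_) k+j≡m (m<m+n k (s≤s z≤n))

module PairCounts where

  open import Defs using (countPairs)
  open import Data.Nat
  open import Data.Nat.Properties
  open import Data.Fin using (Fin; zero; suc; toℕ)
  open import Data.List using (map; allFin; tabulate)
  open import Data.Nat.ListAction using (sum)
  open import Data.Bool using (Bool; true; false; if_then_else_)
  open import Relation.Nullary.Decidable using (⌊_⌋)
  open import Relation.Binary.PropositionalEquality
  open import Relation.Nullary using (yes; no; contradiction)
  open FiniteSums
  open TupleSums using (pairSum)
  open ≡-Reasoning

  ∑Pairs : ∀ {n} → (Fin n → Fin n → ℕ) → ℕ
  ∑Pairs W = ∑ (λ i → ∑ (λ j → if ⌊ toℕ i <? toℕ j ⌋ then W i j else 0))

  countPairs≡∑Pairs : ∀ {n} (P : Fin n → Fin n → Bool) → countPairs P ≡ ∑Pairs (λ i j → indicator (P i j))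
  countPairs≡∑Pairs {n} P = begin
    sum (map (λ i → sum (map (term i) (allFin n))) (allFin n))
      ≡⟨ sum-map-allFin (λ i → sum (map (term i) (allFin n))) ⟩
    ∑ (λ i → sum (map (term i) (allFin n)))
      ≡⟨ sum-cong-≗ (λ i → trans (sum-map-allFin (term i)) (sum-cong-≗ (term≡ i))) ⟩
    ∑Pairs (λ i j → indicator (P i j)) ∎
    where
    term : Fin n → Fin n → ℕ
    term i j = if ⌊ toℕ i <? toℕ j ⌋ then (if P i j then 1 else 0) else 0
    term≡ : ∀ i j → term i j ≡ (if ⌊ toℕ i <? toℕ j ⌋ then indicator (P i j) else 0)
    term≡ i j with ⌊ toℕ i <? toℕ j ⌋ | P i j
    ... | true  | true  = refl
    ... | true  | false = refl
    ... | false | _     = refl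
    sum-map-allFin : (f : Fin n → ℕ) → sum (map f (allFin n)) ≡ ∑ f
    sum-map-allFin f = trans (sum-map≡sumMap f (allFin n)) (sumMap-tabulate f (λ i → i))

  ∑Pairs-suc : ∀ {n} (W : Fin (suc n) → Fin (suc n) → ℕ) →
               ∑Pairs W ≡ ∑ (λ j → W zero (suc j)) + ∑Pairs (λ i j → W (suc i) (suc j))
  ∑Pairs-suc W = cong (∑ (λ j → W zero (suc j)) +_)
    (sum-cong-≗ (λ i → sum-cong-≗ (λ j → ifLess-suc (toℕ i) (toℕ j) (W (suc i) (suc j)))))
    where
    ifLess-suc : ∀ a b w → (if ⌊ suc a <? suc b ⌋ then w else 0) ≡ (if ⌊ a <? b ⌋ then w else 0)
    ifLess-suc a b w with a <? b | suc a <? suc b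
    ... | yes _   | yes _   = refl
    ... | no  _   | no  _   = refl
    ... | yes a<b | no  ¬<  = contradiction (s<s a<b) ¬<
    ... | no  ¬<  | yes s<  = contradiction (s<s⁻¹ s<) ¬<

  pairSum-tabulate : ∀ {a} {A : Set a} {n} (W : A → A → ℕ) (g : Fin n → A) →
                     pairSum W (tabulate g) ≡ ∑Pairs (λ i j → W (g i) (g j))
  pairSum-tabulate {n = zero}  W g = refl
  pairSum-tabulate {n = suc n} W g = begin
    sumMap (W (g zero)) (tabulate (λ i → g (suc i))) + pairSum W (tabulate (λ i → g (suc i)))
      ≡⟨ cong₂ _+_ (sumMap-tabulate (W (g zero)) (λ i → g (suc i))) (pairSum-tabulate W (λ i → g (suc i))) ⟩
    ∑ (λ j → W (g zero) (g (suc j))) + ∑Pairs (λ i j → W (g (suc i)) (g (suc j)))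
      ≡⟨ sym (∑Pairs-suc (λ i j → W (g i) (g j))) ⟩
    ∑Pairs (λ i j → W (g i) (g j)) ∎

module ColourCounts where

  open import Defs
  open import Data.Nat
  open import Data.Nat.Properties
  open import Data.Nat.Combinatorics using (_C_)
  import Data.Fin as Fin
  open import Data.Fin using (Fin; toℕ) renaming (_≟_ to _≟ᶠ_)
  open import Data.Fin.Properties using (toℕ-injective)
  open import Data.List using (List; allFin; length; lookup; tabulate)
  open import Data.List.Properties using (tabulate-lookup; length-tabulate)
  open import Data.List.Membership.Propositional.Properties using (∈-lookup)
  open import Data.List.Relation.Unary.All as All using (All)
  open import Data.List.Relation.Unary.AllPairs using (AllPairs; _∷_)
  open import Data.Bool using (Bool; true; false; not)
  open import Data.Maybe using (Maybe; just; nothing; is-just)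
  open import Data.Product using (_,_)
  open import Relation.Nullary using (yes; no; ¬_; contradiction)
  open import Relation.Binary.Definitions using (tri<; tri≈; tri>)
  open import Relation.Binary.PropositionalEquality
  open import Function.Definitions using (Injective)
  open FiniteSums
  open TupleSums using (pairSum; pairSum-cong; pairSum-+; pairSum-1; crossSum-self)
  open PairCounts
  open GreedyCliques
  open ≡-Reasoning

  module GraphCounts {n : ℕ} (G : BiGraph n) where

    adj : Fin n → Fin n → Bool
    adj x y = is-just (col G x y)

    open GreedyClique adj public

    ¬Adj-refl : ∀ x → ¬ Adj x x
    ¬Adj-refl x = subst (λ c → is-just c ≢ true) (sym (irrefl G x)) (λ ())

    colourEdge : Colour → Fin n → Fin n → ℕ
    colourEdge c x y = indicator (isColour c (col G x y))

    colourEdge-sym : ∀ c x y → colourEdge c x y ≡ colourEdge c y x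
    colourEdge-sym c x y = cong (λ z → indicator (isColour c z)) (symm G x y)

    nonAdj-sym : ∀ x y → nonAdj x y ≡ nonAdj y x
    nonAdj-sym x y = cong (λ z → indicator (not (is-just z))) (symm G x y)

    edge≡red+blue : ∀ x y → indicator (adj x y) ≡ colourEdge red x y + colourEdge blue x y
    edge≡red+blue x y with col G x y
    ... | nothing   = refl
    ... | just red  = refl
    ... | just blue = refl

    red+blue+nonAdj≡1 : ∀ x y → colourEdge red x y + colourEdge blue x y + nonAdj x y ≡ 1
    red+blue+nonAdj≡1 x y with col G x y
    ... | nothing   = refl
    ... | just red  = refl
    ... | just blue = refl

    eCol≡pairSum : ∀ c → eCol c G ≡ pairSum (colourEdge c) (allFin n)
    eCol≡pairSum c = trans (countPairs≡∑Pairs (λ i j → isColour c (col G i j))) (sym (pairSum-tabulate (colourEdge c) (λ i → i)))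

    e≡pairSum : e G ≡ pairSum (λ x y → indicator (adj x y)) (allFin n)
    e≡pairSum = trans (countPairs≡∑Pairs adj) (sym (pairSum-tabulate (λ x y → indicator (adj x y)) (λ i → i)))

    e≡eRed+eBlue : e G ≡ eCol red G + eCol blue G
    e≡eRed+eBlue = begin
      e G                                                    ≡⟨ e≡pairSum ⟩
      pairSum (λ x y → indicator (adj x y)) (allFin n)       ≡⟨ pairSum-cong edge≡red+blue (allFin n) ⟩
      pairSum (λ x y → colourEdge red x y + colourEdge blue x y) (allFin n) ≡⟨ pairSum-+ (colourEdge red) (colourEdge blue) (allFin n) ⟩
      pairSum (colourEdge red) (allFin n) + pairSum (colourEdge blue) (allFin n) ≡⟨ sym (cong₂ _+_ (eCol≡pairSum red) (eCol≡pairSum blue)) ⟩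
      eCol red G + eCol blue G ∎

    e+defects≡C2 : e G + defects (allFin n) ≡ n C 2
    e+defects≡C2 = begin
      e G + defects (allFin n)
        ≡⟨ cong (_+ defects (allFin n)) e≡pairSum ⟩
      pairSum (λ x y → indicator (adj x y)) (allFin n) + defects (allFin n)
        ≡⟨ sym (pairSum-+ (λ x y → indicator (adj x y)) nonAdj (allFin n)) ⟩
      pairSum (λ x y → indicator (adj x y) + nonAdj x y) (allFin n)
        ≡⟨ pairSum-cong edge+nonAdj≡1 (allFin n) ⟩
      pairSum (λ _ _ → 1) (allFin n)
        ≡⟨ pairSum-1 (allFin n) ⟩
      length (allFin n) C 2
        ≡⟨ cong (_C 2) (length-tabulate {n = n} (λ i → i)) ⟩
      n C 2 ∎
      where
      edge+nonAdj≡1 : ∀ x y → indicator (adj x y) + nonAdj x y ≡ 1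
      edge+nonAdj≡1 x y with adj x y
      ... | true  = refl
      ... | false = refl

    ∑²-symmetric : ∀ W → (∀ x y → W x y ≡ W y x) → ∑² W ≡ 2 * pairSum W (allFin n) + ∑ (λ x → W x x)
    ∑²-symmetric W W-sym = begin
      ∑² W                                                            ≡⟨ ∑²-allFin W ⟩
      crossSum′ W                                                     ≡⟨ crossSum-self W W-sym (allFin n) ⟩
      2 * pairSum W (allFin n) + sumMap (λ x → W x x) (allFin n)      ≡⟨ cong (2 * pairSum W (allFin n) +_) (sumMap-tabulate (λ x → W x x) (λ i → i)) ⟩
      2 * pairSum W (allFin n) + ∑ (λ x → W x x)                      ∎
      where
      crossSum′ : (Fin n → Fin n → ℕ) → ℕ
      crossSum′ W = sumMap (λ x → sumMap (W x) (allFin n)) (allFin n)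

    ∑²-colourEdge : ∀ c → ∑² (colourEdge c) ≡ 2 * eCol c G
    ∑²-colourEdge c = begin
      ∑² (colourEdge c)                                           ≡⟨ ∑²-symmetric (colourEdge c) (colourEdge-sym c) ⟩
      2 * pairSum (colourEdge c) (allFin n) + ∑ (λ x → colourEdge c x x) ≡⟨ cong₂ (λ p d → 2 * p + d) (sym (eCol≡pairSum c)) loopless ⟩
      2 * eCol c G + 0                                            ≡⟨ +-identityʳ _ ⟩
      2 * eCol c G                                                ∎
      where
      loopless : ∑ (λ x → colourEdge c x x) ≡ 0
      loopless = trans (sum-cong-≗ (λ x → trans (cong (λ z → indicator (isColour c z)) (irrefl G x)) (no-colour c)))
                       (∑-const {n} 0)
        where
        no-colour : ∀ c → indicator (isColour c nothing) ≡ 0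
        no-colour red  = refl
        no-colour blue = refl

    ∑²-nonAdj : ∑² nonAdj ≡ 2 * defects (allFin n) + n
    ∑²-nonAdj = begin
      ∑² nonAdj                                         ≡⟨ ∑²-symmetric nonAdj nonAdj-sym ⟩
      2 * defects (allFin n) + ∑ (λ x → nonAdj x x)     ≡⟨ cong (2 * defects (allFin n) +_) loops ⟩
      2 * defects (allFin n) + n                        ∎
      where
      loops : ∑ (λ x → nonAdj x x) ≡ n
      loops = trans (sum-cong-≗ (λ x → cong (λ z → indicator (not (is-just z))) (irrefl G x)))
                    (trans (∑-const {n} 1) (*-identityˡ n))

    ∑²-red+blue+nonAdj : ∑² (colourEdge red) + ∑² (colourEdge blue) + ∑² nonAdj ≡ n * n
    ∑²-red+blue+nonAdj = begin
      ∑² (colourEdge red) + ∑² (colourEdge blue) + ∑² nonAdj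
        ≡⟨ cong (_+ ∑² nonAdj) (sym (∑²-+ (colourEdge red) (colourEdge blue))) ⟩
      ∑² (λ x y → colourEdge red x y + colourEdge blue x y) + ∑² nonAdj
        ≡⟨ sym (∑²-+ (λ x y → colourEdge red x y + colourEdge blue x y) nonAdj) ⟩
      ∑² (λ x y → colourEdge red x y + colourEdge blue x y + nonAdj x y)
        ≡⟨ sum-cong-≗ (λ x → sum-cong-≗ (red+blue+nonAdj≡1 x)) ⟩
      ∑ {n} (λ _ → ∑ {n} (λ _ → 1))
        ≡⟨ trans (∑-const (∑ {n} (λ _ → 1))) (cong (_* n) (trans (∑-const 1) (*-identityˡ n))) ⟩
      n * n ∎

  induced : ∀ {n} → BiGraph n → (ks : List (Fin n)) → BiGraph (length ks)
  induced G ks = record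
    { col    = λ i j → col G (lookup ks i) (lookup ks j)
    ; symm   = λ i j → symm G (lookup ks i) (lookup ks j)
    ; irrefl = λ i → irrefl G (lookup ks i)
    }

  AllPairs-lookup : ∀ {a r} {A : Set a} {R : A → A → Set r} {xs} → AllPairs R xs →
                    ∀ i j → toℕ i < toℕ j → R (lookup xs i) (lookup xs j)
  AllPairs-lookup (x~xs ∷ _)  Fin.zero    (Fin.suc j) _         = All.lookup x~xs (∈-lookup j)
  AllPairs-lookup (_ ∷ xs!)   (Fin.suc i) (Fin.suc j) (s≤s i<j) = AllPairs-lookup xs! i j i<j

  module Induced {n : ℕ} (G : BiGraph n) (ks : List (Fin n)) where

    open GraphCounts G

    module _ (clique : AllPairs Adj ks) where

      clique-adj : ∀ i j → i ≢ j → Adj (lookup ks i) (lookup ks j)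
      clique-adj i j i≢j with <-cmp (toℕ i) (toℕ j)
      ... | tri< i<j _ _ = AllPairs-lookup clique i j i<j
      ... | tri≈ _ i≡j _ = contradiction (toℕ-injective i≡j) i≢j
      ... | tri> _ _ j<i = trans (cong is-just (symm G _ _)) (AllPairs-lookup clique j i j<i)

      induced-complete : Complete (induced G ks)
      induced-complete = clique-adj

      -- a clique has no repeated entries, since adj x x = false
      lookup-injective : Injective _≡_ _≡_ (lookup ks)
      lookup-injective {i} {j} ki≡kj with i ≟ᶠ j
      ... | yes i≡j = i≡j
      ... | no  i≢j = contradiction (subst (λ k → Adj k (lookup ks j)) ki≡kj (clique-adj i j i≢j)) (¬Adj-refl (lookup ks j))

      induced-contains : ∀ {m} (h : Fin m → Fin m → Maybe Colour) → ContainsCol (induced G ks) h → ContainsCol G h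
      induced-contains h (f , f-inj , f-col) = (λ i → lookup ks (f i)) , (λ eq → f-inj (lookup-injective eq)) , f-col

    eCol-induced : ∀ c → eCol c (induced G ks) ≡ pairSum (colourEdge c) ks
    eCol-induced c = begin
      eCol c (induced G ks)                         ≡⟨ countPairs≡∑Pairs (λ i j → isColour c (col (induced G ks) i j)) ⟩
      ∑Pairs (λ i j → colourEdge c (lookup ks i) (lookup ks j)) ≡⟨ sym (pairSum-tabulate (colourEdge c) (lookup ks)) ⟩
      pairSum (colourEdge c) (tabulate (lookup ks)) ≡⟨ cong (pairSum (colourEdge c)) (tabulate-lookup ks) ⟩
      pairSum (colourEdge c) ks                     ∎

    e-induced : e (induced G ks) ≡ pairSum (colourEdge red) ks + pairSum (colourEdge blue) ks
    e-induced = trans (GraphCounts.e≡eRed+eBlue (induced G ks)) (cong₂ _+_ (eCol-induced red) (eCol-induced blue))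

module Fractions where

  open import Defs using (toℚ; inv; threshold)
  open import Data.Nat.Combinatorics using (_C_)
  open import Data.Nat as ℕ using (ℕ; zero; suc; s≤s; z≤n)
  import Data.Nat.Properties as ℕ
  open import Data.Integer as ℤ using (+_; +[1+_]; -[1+_]; +≤+; +<+)
  import Data.Integer.Properties as ℤ
  import Data.Rational
  open import Data.Rational using (ℚ; mkℚ; 0ℚ; 1ℚ; ½; _≤_; _<_; _*_; _-_; toℚᵘ; *≤*; *<*)
  open import Data.Rational.Properties
    using (normalize-coprime; toℚᵘ-mono-≤; toℚᵘ-cancel-≤; toℚᵘ-homo-*; toℚᵘ-homo-+; toℚᵘ-injective; drop-*≤*; drop-*<*)
    renaming (_≟_ to _≟ℚ_)
  open import Data.Rational.Unnormalised as ᵘ using (mkℚᵘ; _≃_)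
  import Data.Rational.Unnormalised.Properties as ᵘ
  open import Data.Nat.Coprimality using (Coprime; 1-coprimeTo) renaming (sym to coprime-sym)
  open import Data.Sign using (Sign)
  open import Relation.Nullary using (yes; no; contradiction)
  open import Relation.Binary.PropositionalEquality

  -- numerator suc P, denominator suc d
  data PositiveFraction : ℚ → Set where
    fraction : ∀ P d .(c : Coprime (suc P) (suc d)) → PositiveFraction (mkℚ (+ suc P) d c)

  positiveFraction : ∀ ε → 0ℚ < ε → PositiveFraction ε
  positiveFraction (mkℚ (+ suc P) d c) _ = fraction P d c
  positiveFraction (mkℚ (+ zero) d c) 0<0 with drop-*<* 0<0
  ... | +<+ ()
  positiveFraction (mkℚ -[1+ k ] d c) 0<neg with drop-*<* 0<neg
  ... | ()

  toℚᵘ-toℚ : ∀ m → toℚᵘ (toℚ m) ≡ mkℚᵘ (+ m) 0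
  toℚᵘ-toℚ m = cong toℚᵘ (normalize-coprime (coprime-sym (1-coprimeTo m)))

  toℚ-positive : ∀ K .{{_ : ℕ.NonZero K}} → 0ℚ < toℚ K
  toℚ-positive (suc k) = subst (0ℚ <_) (sym (normalize-coprime (coprime-sym (1-coprimeTo (suc k))))) (*<* (+<+ (s≤s z≤n)))

  toℚ-* : ∀ a b → toℚ a * toℚ b ≡ toℚ (a ℕ.* b)
  toℚ-* a b = toℚᵘ-injective (ᵘ.≃-trans (toℚᵘ-homo-* (toℚ a) (toℚ b))
    (subst₂ _≃_ (sym (cong₂ ᵘ._*_ (toℚᵘ-toℚ a) (toℚᵘ-toℚ b))) (sym (toℚᵘ-toℚ (a ℕ.* b)))
                (ᵘ.≃-reflexive (cong (λ z → mkℚᵘ z 0) (ℤ.+◃n≡+n (a ℕ.* b))))))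

  module _ (P d : ℕ) .(c : Coprime P (suc d)) (a b : ℕ) where

    private
      ε : ℚ
      ε = mkℚ (+ P) d c

      toℚᵘ-ε*a : toℚᵘ (ε * toℚ a) ≃ mkℚᵘ (+ P) d ᵘ.* mkℚᵘ (+ a) 0
      toℚᵘ-ε*a = subst (λ z → toℚᵘ (ε * toℚ a) ≃ mkℚᵘ (+ P) d ᵘ.* z) (toℚᵘ-toℚ a) (toℚᵘ-homo-* ε (toℚ a))

      lhs : (Sign.+ ℤ.◃ (P ℕ.* a)) ℤ.* + 1 ≡ + (P ℕ.* a)
      lhs = trans (ℤ.*-identityʳ _) (ℤ.+◃n≡+n (P ℕ.* a))

      rhs : + b ℤ.* + suc (d ℕ.* 1) ≡ + (suc d ℕ.* b)
      rhs = trans (sym (ℤ.pos-* b (suc (d ℕ.* 1)))) (cong +_ (trans (cong (λ k → b ℕ.* suc k) (ℕ.*-identityʳ d)) (ℕ.*-comm b (suc d))))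

    fraction*toℚ-≤⇒ : ε * toℚ a ≤ toℚ b → P ℕ.* a ℕ.≤ suc d ℕ.* b
    fraction*toℚ-≤⇒ εa≤b with subst (_ ᵘ.≤_) (toℚᵘ-toℚ b) (ᵘ.≤-respˡ-≃ toℚᵘ-ε*a (toℚᵘ-mono-≤ εa≤b))
    ... | ᵘ.*≤* Pa≤db = ℤ.drop‿+≤+ (subst₂ ℤ._≤_ lhs rhs Pa≤db)

    fraction*toℚ-≤⇐ : P ℕ.* a ℕ.≤ suc d ℕ.* b → ε * toℚ a ≤ toℚ b
    fraction*toℚ-≤⇐ Pa≤db = toℚᵘ-cancel-≤ (subst (_ ᵘ.≤_) (sym (toℚᵘ-toℚ b))
      (ᵘ.≤-respˡ-≃ (ᵘ.≃-sym toℚᵘ-ε*a) (ᵘ.*≤* (subst₂ ℤ._≤_ (sym lhs) (sym rhs) (+≤+ Pa≤db)))))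

  fraction-≤½⇒ : ∀ P d .(c : Coprime P (suc d)) → mkℚ (+ P) d c ≤ ½ → 2 ℕ.* P ℕ.≤ suc d
  fraction-≤½⇒ P d c ε≤½ = subst₂ ℕ._≤_ (ℕ.*-comm P 2) (cong suc (ℕ.+-identityʳ d))
    (ℤ.drop‿+≤+ (subst (ℤ._≤ _) (ℤ.+◃n≡+n _) (drop-*≤* ε≤½)))

  fraction-<⇒ : ∀ p d′ P d .(c′ : Coprime p (suc d′)) .(c : Coprime P (suc d)) →
                mkℚ (+ p) d′ c′ < mkℚ (+ P) d c → p ℕ.* suc d ℕ.< P ℕ.* suc d′
  fraction-<⇒ p d′ P d c′ c ε′<ε = ℤ.drop‿+<+ (subst₂ ℤ._<_ (ℤ.+◃n≡+n _) (ℤ.+◃n≡+n _) (drop-*<* ε′<ε))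

  private
    1/[1+_] : ℕ → ℚ
    1/[1+ X ] = mkℚ (+ 1) X (coprime-sym (coprime-sym (1-coprimeTo (suc X))))

  inv-mkℚ : ∀ X .(c : Coprime (suc X) 1) → inv (mkℚ +[1+ X ] 0 c) ≡ 1/[1+ X ]
  inv-mkℚ X c with mkℚ +[1+ X ] 0 c ≟ℚ 0ℚ
  ... | yes X≡0 = contradiction (cong ℚ.numerator X≡0) (λ ())
  ... | no  _   = refl

  1-1/X-≤⇒ : ∀ X N e → (1ℚ - 1/[1+ X ]) * toℚ N ≤ toℚ e → suc X ℕ.* N ℕ.≤ suc X ℕ.* e ℕ.+ N
  1-1/X-≤⇒ X N e thr with subst (_ ᵘ.≤_) (toℚᵘ-toℚ e) (ᵘ.≤-respˡ-≃ toℚᵘ-lhs (toℚᵘ-mono-≤ thr))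
    where
    toℚᵘ-lhs : toℚᵘ ((1ℚ - 1/[1+ X ]) * toℚ N) ≃ (mkℚᵘ (+ 1) 0 ᵘ.+ mkℚᵘ -[1+ 0 ] X) ᵘ.* mkℚᵘ (+ N) 0
    toℚᵘ-lhs = ᵘ.≃-trans (toℚᵘ-homo-* (1ℚ - 1/[1+ X ]) (toℚ N))
                         (ᵘ.*-cong (toℚᵘ-homo-+ 1ℚ (Data.Rational.- 1/[1+ X ])) (ᵘ.≃-reflexive (toℚᵘ-toℚ N)))
  ... | ᵘ.*≤* XC≤Xe = subst (N ℕ.+ X ℕ.* N ℕ.≤_) (ℕ.+-comm N (suc X ℕ.* e)) (ℕ.+-monoʳ-≤ N XC≤[1+X]e)
    where
    XC≤[1+X]e : X ℕ.* N ℕ.≤ suc X ℕ.* e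
    XC≤[1+X]e = subst₂ ℕ._≤_ (cong (ℕ._* N) (ℕ.+-identityʳ X))
      (trans (cong (λ k → e ℕ.* suc k) (trans (ℕ.*-identityʳ _) (ℕ.+-identityʳ X))) (ℕ.*-comm e (suc X)))
      (ℤ.drop‿+≤+ (subst₂ ℤ._≤_ (trans (ℤ.*-identityʳ _) (ℤ.+◃n≡+n _)) (sym (ℤ.pos-* e _)) XC≤Xe))

  threshold-≤⇒ : ∀ K R n e .{{_ : ℕ.NonZero K}} → threshold (toℚ K) (suc R) n ≤ toℚ e →
                 K ℕ.* suc R ℕ.* (n C 2) ℕ.≤ K ℕ.* suc R ℕ.* e ℕ.+ (n C 2)
  threshold-≤⇒ (suc K) R n e thr = 1-1/X-≤⇒ X (n C 2) e (subst (λ z → (1ℚ - z) * toℚ (n C 2) ≤ toℚ e) inv-KR thr)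
    where
    X : ℕ
    X = R ℕ.+ K ℕ.* suc R
    inv-KR : inv (toℚ (suc K) * toℚ (suc R)) ≡ 1/[1+ X ]
    inv-KR = trans (cong inv (trans (toℚ-* (suc K) (suc R)) (normalize-coprime (coprime-sym (1-coprimeTo (suc X))))))
                   (inv-mkℚ X (coprime-sym (1-coprimeTo (suc X))))

module Parameters where

  open import Data.Nat
  open import Data.Nat.Properties
  open import Data.Nat.Combinatorics using (_C_)
  open import Relation.Binary.PropositionalEquality
  open import Data.Nat.Tactic.RingSolver using (solve-∀)
  open TupleSums using (2*[1+m]C2≡[1+m]*m)
  open ≤-Reasoning

  -- The averaging step, with the common factor n^(m+1) cancelled: a colour class
  -- holding a P/Q > b/q share of the ordered pairs exceeds, on average over all
  -- m-tuples, the b/q share of their T pairs by any penalty Y within budget.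
  heavy-on-average : ∀ P Q′ b q T N2 R Bd Y →
                     P * N2 ≤ suc Q′ * R + P * Bd → b * suc Q′ + 1 ≤ q * P →
                     suc Q′ * Y + q * T * P * Bd ≤ T * N2 → b * T * N2 + Y ≤ q * T * R
  heavy-on-average P Q′ b q T N2 R Bd Y balance gap budget =
    *-cancelˡ-≤ Q (+-cancelʳ-≤ (q * T * P * Bd) _ _ (begin
      Q * (b * T * N2 + Y) + q * T * P * Bd  ≡⟨ ring₁ Q b T N2 Y (q * T * P * Bd) ⟩
      b * Q * (T * N2) + (Q * Y + q * T * P * Bd) ≤⟨ +-monoʳ-≤ (b * Q * (T * N2)) budget ⟩
      b * Q * (T * N2) + T * N2              ≡⟨ ring₂ (b * Q) (T * N2) ⟩
      (b * Q + 1) * (T * N2)                 ≤⟨ *-monoˡ-≤ (T * N2) gap ⟩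
      q * P * (T * N2)                       ≡⟨ ring₃ q P T N2 ⟩
      q * T * (P * N2)                       ≤⟨ *-monoʳ-≤ (q * T) balance ⟩
      q * T * (Q * R + P * Bd)               ≡⟨ ring₄ q T Q R P Bd ⟩
      Q * (q * T * R) + q * T * P * Bd       ∎))
    where
    Q : ℕ
    Q = suc Q′
    ring₁ : ∀ Q b T N Y z → Q * (b * T * N + Y) + z ≡ b * Q * (T * N) + (Q * Y + z)
    ring₁ = solve-∀
    ring₂ : ∀ x y → x * y + y ≡ (x + 1) * y
    ring₂ = solve-∀
    ring₃ : ∀ q P T N → q * P * (T * N) ≡ q * T * (P * N)
    ring₃ = solve-∀
    ring₄ : ∀ q T Q R P B → q * T * (Q * R + P * B) ≡ Q * (q * T * R) + q * T * P * B
    ring₄ = solve-∀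

  quarters : ∀ x₁ x₂ x₃ x₄ Z → 4 * x₁ ≤ Z → 4 * x₂ ≤ Z → 4 * x₃ ≤ Z → 4 * x₄ ≤ Z → x₁ + x₂ + x₃ + x₄ ≤ Z
  quarters x₁ x₂ x₃ x₄ Z h₁ h₂ h₃ h₄ = *-cancelˡ-≤ 4 (begin
    4 * (x₁ + x₂ + x₃ + x₄)           ≡⟨ *-distribˡ-+ 4 (x₁ + x₂ + x₃) x₄ ⟩
    4 * (x₁ + x₂ + x₃) + 4 * x₄        ≡⟨ cong (_+ 4 * x₄) (*-distribˡ-+ 4 (x₁ + x₂) x₃) ⟩
    4 * (x₁ + x₂) + 4 * x₃ + 4 * x₄    ≡⟨ cong (λ z → z + 4 * x₃ + 4 * x₄) (*-distribˡ-+ 4 x₁ x₂) ⟩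
    4 * x₁ + 4 * x₂ + 4 * x₃ + 4 * x₄  ≤⟨ +-mono-≤ (+-mono-≤ (+-mono-≤ h₁ h₂) h₃) h₄ ⟩
    Z + Z + Z + Z                      ≡⟨ ring Z ⟩
    4 * Z                              ∎)
    where
    ring : ∀ z → z + z + z + z ≡ 4 * z
    ring = solve-∀

  -- The parameters of the tuple selection: ε = P/Q, ε′ = b/q with q = b + a and
  -- b < a, R(ε′,t) = r.  Tuples have length m = c r + 1, so T = (m choose 2)
  -- pairs, and Δ = 2r bounds the number of non-edges inside a selected tuple.
  module Constants (Q′ b e : ℕ) where

    Q a q : ℕ
    Q = suc Q′
    a = b + suc e
    q = b + a

    opaque
      c : ℕ
      c = 16 * Q * (1 + a + b)

      instance
        c-nonZero : NonZero c
        c-nonZero = m*n≢0 (16 * Q) (1 + a + b) {{m*n≢0 16 Q}}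

      16Qa≤c : 16 * Q * a ≤ c
      16Qa≤c = *-monoʳ-≤ (16 * Q) (≤-trans (m≤n+m a 1) (m≤m+n (1 + a) b))

      4+2b+10a≤c : 4 + 2 * b + 10 * a ≤ c
      4+2b+10a≤c = begin
        4 + 2 * b + 10 * a  ≤⟨ slack a b ⟩
        16 * (1 + a + b)    ≤⟨ *-monoˡ-≤ (1 + a + b) (*-monoʳ-≤ 16 (s≤s (z≤n {Q′}))) ⟩
        16 * Q * (1 + a + b) ∎
        where
        slack : ∀ a b → 4 + 2 * b + 10 * a ≤ 16 * (1 + a + b)
        slack a b = subst (4 + 2 * b + 10 * a ≤_) (ring a b) (m≤m+n _ (12 + 6 * a + 14 * b))
          where
          ring : ∀ a b → 4 + 2 * b + 10 * a + (12 + 6 * a + 14 * b) ≡ 16 * (1 + a + b)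
          ring = solve-∀

    0<q : 0 < q
    0<q = ≤-trans (s≤s z≤n) (≤-trans (m≤n+m (suc e) b) (m≤n+m a b))

    instance
      q-nonZero : NonZero q
      q-nonZero = >-nonZero 0<q

    3≤c : 3 ≤ c
    3≤c = ≤-trans (m≤m+n 3 (1 + 2 * b + 10 * a)) (≤-trans (≤-reflexive (ring b a)) 4+2b+10a≤c)
      where
      ring : ∀ b a → 3 + (1 + 2 * b + 10 * a) ≡ 4 + 2 * b + 10 * a
      ring = solve-∀

    module Sizes (r′ : ℕ) where

      r Δ : ℕ
      r = suc r′
      Δ = 2 * r

      opaque
        m : ℕ
        m = suc (c * r)

        instance
          m-nonZero : NonZero m
          m-nonZero = _

        2T≡mcr : 2 * (m C 2) ≡ m * (c * r)
        2T≡mcr = 2*[1+m]C2≡[1+m]*m (c * r)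

        m≤[1+c]r : m ≤ (1 + c) * r
        m≤[1+c]r = +-monoˡ-≤ (c * r) (s≤s z≤n)

        cr≤m : c * r ≤ m
        cr≤m = n≤1+n _

      T : ℕ
      T = m C 2

      W₁ W₂ : ℕ
      W₁ = q * m * c
      W₂ = 8 * Q * (q * q) * (m * m) * c

      r+Δ≤m : r + Δ ≤ m
      r+Δ≤m = begin
        r + 2 * r  ≡⟨ ring r ⟩
        3 * r      ≤⟨ *-monoˡ-≤ r 3≤c ⟩
        c * r      ≤⟨ cr≤m ⟩
        m          ∎
        where
        ring : ∀ r → r + 2 * r ≡ 3 * r
        ring = solve-∀

      -- the hypothesis T-large of the crossing argument, with step size L = m
      T-large : Δ + b * m + a * m + 2 * (a * m * Δ) ≤ T
      T-large = *-cancelˡ-≤ 2 (begin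
        2 * (Δ + b * m + a * m + 2 * (a * m * Δ))                    ≡⟨ ring₁ r b m a ⟩
        4 * r + 2 * b * m + 2 * a * m + 8 * a * m * r                ≤⟨ +-monoˡ-≤ (8 * a * m * r)
                                                                         (+-mono-≤ (+-mono-≤ (*-monoʳ-≤ 4 r≤mr) (*-monoʳ-≤ (2 * b) m≤mr))
                                                                                   (*-monoʳ-≤ (2 * a) m≤mr)) ⟩
        4 * (m * r) + 2 * b * (m * r) + 2 * a * (m * r) + 8 * a * m * r ≡⟨ ring₂ m r a b ⟩
        m * r * (4 + 2 * b + 10 * a)                                 ≤⟨ *-monoʳ-≤ (m * r) 4+2b+10a≤c ⟩
        m * r * c                                                    ≡⟨ ring₃ m r c ⟩
        m * (c * r)                                                  ≡⟨ sym 2T≡mcr ⟩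
        2 * T                                                        ∎)
        where
        r≤mr : r ≤ m * r
        r≤mr = m≤n*m r m
        m≤mr : m ≤ m * r
        m≤mr = m≤m*n m r
        ring₁ : ∀ r b m a → 2 * (2 * r + b * m + a * m + 2 * (a * m * (2 * r))) ≡ 4 * r + 2 * b * m + 2 * a * m + 8 * a * m * r
        ring₁ = solve-∀
        ring₂ : ∀ m r a b → 4 * (m * r) + 2 * b * (m * r) + 2 * a * (m * r) + 8 * a * m * r ≡ m * r * (4 + 2 * b + 10 * a)
        ring₂ = solve-∀
        ring₃ : ∀ m r c → m * r * c ≡ m * (c * r)
        ring₃ = solve-∀

      W₁-small⇒ : ∀ x → W₁ * x ≤ q * T → 2 * x ≤ r
      W₁-small⇒ x W₁x≤qT = *-cancelˡ-≤ (m * c) {{m*n≢0 m c}} (begin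
        m * c * (2 * x)  ≡⟨ ring₁ m c x ⟩
        2 * (m * c * x)  ≤⟨ *-monoʳ-≤ 2 (*-cancelˡ-≤ q (subst (_≤ q * T) (ring₂ q m c x) W₁x≤qT)) ⟩
        2 * T            ≡⟨ 2T≡mcr ⟩
        m * (c * r)      ≡⟨ sym (*-assoc m c r) ⟩
        m * c * r        ∎)
        where
        ring₁ : ∀ m c x → m * c * (2 * x) ≡ 2 * (m * c * x)
        ring₁ = solve-∀
        ring₂ : ∀ q m c x → q * m * c * x ≡ q * (m * c * x)
        ring₂ = solve-∀

      quarter-cross : ∀ n D → W₂ * D ≤ n * q * T → 4 * (Q * (q * m * c * n * m * D)) ≤ T * (n * n)
      quarter-cross n D W₂D≤nqT = *-cancelˡ-≤ (2 * q) {{m*n≢0 2 q}} (begin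
        2 * q * (4 * (Q * (q * m * c * n * m * D))) ≡⟨ ring₁ Q q m c n D ⟩
        n * (W₂ * D)                                ≤⟨ *-monoʳ-≤ n W₂D≤nqT ⟩
        n * (n * q * T)                             ≡⟨ ring₂ n q T ⟩
        q * (T * (n * n))                           ≤⟨ *-monoˡ-≤ (T * (n * n)) (m≤n+m q q) ⟩
        (q + q) * (T * (n * n))                     ≡⟨ cong (_* (T * (n * n))) (sym (ring₃ q)) ⟩
        2 * q * (T * (n * n))                       ∎)
        where
        ring₁ : ∀ Q q m c n D → 2 * q * (4 * (Q * (q * m * c * n * m * D))) ≡ n * (8 * Q * (q * q) * (m * m) * c * D)
        ring₁ = solve-∀
        ring₂ : ∀ n q T → n * (n * q * T) ≡ q * (T * (n * n))
        ring₂ = solve-∀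
        ring₃ : ∀ q → 2 * q ≡ q + q
        ring₃ = solve-∀

      -- With K large, the density condition K r Bd ≤ 2 N2 on the ordered non-edges Bd
      -- makes each penalty at most a quarter of the T N2 available.
      module Budget (K P N2 Bd : ℕ) (sparse : K * r * Bd ≤ 2 * N2)
                    (K-large₁ : 8 * Q * q * (1 + c) * c ≤ K)
                    (K-large₂ : 128 * (Q * Q) * (q * q) * ((1 + c) * (1 + c)) ≤ K)
                    (K-large₃ : 8 * q * P ≤ K) where

        quarter-Δ : 4 * (Q * (a * m * Δ * N2)) ≤ T * N2
        quarter-Δ = *-cancelˡ-≤ 2 (begin
          2 * (4 * (Q * (a * m * Δ * N2))) ≡⟨ ring₁ Q a m r N2 ⟩
          16 * Q * a * (m * r * N2)        ≤⟨ *-monoˡ-≤ (m * r * N2) 16Qa≤c ⟩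
          c * (m * r * N2)                 ≡⟨ ring₂ c m r N2 ⟩
          m * (c * r) * N2                 ≡⟨ cong (_* N2) (sym 2T≡mcr) ⟩
          2 * T * N2                       ≡⟨ *-assoc 2 T N2 ⟩
          2 * (T * N2)                     ∎)
          where
          ring₁ : ∀ Q a m r N → 2 * (4 * (Q * (a * m * (2 * r) * N))) ≡ 16 * Q * a * (m * r * N)
          ring₁ = solve-∀
          ring₂ : ∀ c m r N → c * (m * r * N) ≡ m * (c * r) * N
          ring₂ = solve-∀

        quarter-W₁ : 4 * (Q * (W₁ * T * Bd)) ≤ T * N2
        quarter-W₁ = *-cancelˡ-≤ 2 (begin
          2 * (4 * (Q * (q * m * c * T * Bd)))             ≡⟨ ring₁ Q q m c T Bd ⟩
          8 * Q * q * c * T * Bd * m                        ≤⟨ *-monoʳ-≤ (8 * Q * q * c * T * Bd) m≤[1+c]r ⟩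
          8 * Q * q * c * T * Bd * ((1 + c) * r)            ≡⟨ ring₂ Q q c T Bd r ⟩
          T * (8 * Q * q * (1 + c) * c * r * Bd)            ≤⟨ *-monoʳ-≤ T (*-monoˡ-≤ Bd (*-monoˡ-≤ r K-large₁)) ⟩
          T * (K * r * Bd)                                  ≤⟨ *-monoʳ-≤ T sparse ⟩
          T * (2 * N2)                                      ≡⟨ ring₃ T N2 ⟩
          2 * (T * N2)                                      ∎)
          where
          ring₁ : ∀ Q q m c T B → 2 * (4 * (Q * (q * m * c * T * B))) ≡ 8 * Q * q * c * T * B * m
          ring₁ = solve-∀
          ring₂ : ∀ Q q c T B r → 8 * Q * q * c * T * B * ((1 + c) * r) ≡ T * (8 * Q * q * (1 + c) * c * r * B)
          ring₂ = solve-∀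
          ring₃ : ∀ T N → T * (2 * N) ≡ 2 * (T * N)
          ring₃ = solve-∀

        quarter-W₂ : 4 * (Q * (W₂ * m * Bd)) ≤ T * N2
        quarter-W₂ = *-cancelˡ-≤ 2 (begin
          2 * (4 * (Q * (8 * Q * (q * q) * (m * m) * c * m * Bd))) ≡⟨ ring₁ Q q m c Bd ⟩
          m * c * (64 * (Q * Q) * (q * q) * (m * m) * Bd)         ≤⟨ *-monoʳ-≤ (m * c) m²Bd≤rN2 ⟩
          m * c * (r * N2)                                        ≡⟨ ring₂ m c r N2 ⟩
          m * (c * r) * N2                                        ≡⟨ cong (_* N2) (sym 2T≡mcr) ⟩
          2 * T * N2                                              ≡⟨ *-assoc 2 T N2 ⟩
          2 * (T * N2)                                            ∎)
          where
          ring₁ : ∀ Q q m c B → 2 * (4 * (Q * (8 * Q * (q * q) * (m * m) * c * m * B))) ≡ m * c * (64 * (Q * Q) * (q * q) * (m * m) * B)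
          ring₁ = solve-∀
          ring₂ : ∀ m c r N → m * c * (r * N) ≡ m * (c * r) * N
          ring₂ = solve-∀
          m²Bd≤rN2 : 64 * (Q * Q) * (q * q) * (m * m) * Bd ≤ r * N2
          m²Bd≤rN2 = *-cancelˡ-≤ 2 (begin
            2 * (64 * (Q * Q) * (q * q) * (m * m) * Bd)                      ≡⟨ ring₃ Q q m Bd ⟩
            128 * (Q * Q) * (q * q) * Bd * (m * m)                           ≤⟨ *-monoʳ-≤ (128 * (Q * Q) * (q * q) * Bd) (*-mono-≤ m≤[1+c]r m≤[1+c]r) ⟩
            128 * (Q * Q) * (q * q) * Bd * ((1 + c) * r * ((1 + c) * r))     ≡⟨ ring₄ Q q c Bd r ⟩
            128 * (Q * Q) * (q * q) * ((1 + c) * (1 + c)) * r * Bd * r       ≤⟨ *-monoˡ-≤ r (*-monoˡ-≤ Bd (*-monoˡ-≤ r K-large₂)) ⟩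
            K * r * Bd * r                                                   ≤⟨ *-monoˡ-≤ r sparse ⟩
            2 * N2 * r                                                       ≡⟨ ring₅ N2 r ⟩
            2 * (r * N2)                                                     ∎)
            where
            ring₃ : ∀ Q q m B → 2 * (64 * (Q * Q) * (q * q) * (m * m) * B) ≡ 128 * (Q * Q) * (q * q) * B * (m * m)
            ring₃ = solve-∀
            ring₄ : ∀ Q q c B r → 128 * (Q * Q) * (q * q) * B * ((1 + c) * r * ((1 + c) * r)) ≡ 128 * (Q * Q) * (q * q) * ((1 + c) * (1 + c)) * r * B * r
            ring₄ = solve-∀
            ring₅ : ∀ N r → 2 * N * r ≡ 2 * (r * N)
            ring₅ = solve-∀

        quarter-gap : 4 * (q * T * P * Bd) ≤ T * N2
        quarter-gap = *-cancelˡ-≤ 2 (begin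
          2 * (4 * (q * T * P * Bd)) ≡⟨ ring₁ q T P Bd ⟩
          T * (8 * q * P * Bd)       ≤⟨ *-monoʳ-≤ T (*-monoˡ-≤ Bd (≤-trans K-large₃ (m≤m*n K r))) ⟩
          T * (K * r * Bd)           ≤⟨ *-monoʳ-≤ T sparse ⟩
          T * (2 * N2)               ≡⟨ ring₂ T N2 ⟩
          2 * (T * N2)               ∎)
          where
          ring₁ : ∀ q T P B → 2 * (4 * (q * T * P * B)) ≡ T * (8 * q * P * B)
          ring₁ = solve-∀
          ring₂ : ∀ T N → T * (2 * N) ≡ 2 * (T * N)
          ring₂ = solve-∀

        within-budget : ∀ Z → 4 * (Q * Z) ≤ T * N2 →
                        Q * (a * m * Δ * N2 + W₁ * T * Bd + Z) + q * T * P * Bd ≤ T * N2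
        within-budget Z quarter-Z =
          subst (_≤ T * N2) (ring Q (a * m * Δ * N2) (W₁ * T * Bd) Z (q * T * P * Bd))
            (quarters (Q * (a * m * Δ * N2)) (Q * (W₁ * T * Bd)) (Q * Z) (q * T * P * Bd) (T * N2)
                      quarter-Δ quarter-W₁ quarter-Z quarter-gap)
          where
          ring : ∀ Q x y z w → Q * x + Q * y + Q * z + w ≡ Q * (x + y + z) + w
          ring = solve-∀

module CliqueSelection where

  open import Defs
  open import Data.Nat
  open import Data.Nat.Properties
  open import Data.Nat.Combinatorics using (_C_)
  open import Data.Fin using (Fin)
  open import Data.List using (List; length)
  open import Data.List.Relation.Unary.AllPairs using (AllPairs)
  open import Data.Product using (Σ; _×_; _,_)
  open import Relation.Binary.PropositionalEquality
  open import Data.Nat.Tactic.RingSolver using (solve-∀)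
  open FiniteSums
  open TupleSums
  open Hybrids
  open IntermediateValue using (module Crossing)
  open ColourCounts using (module GraphCounts)
  open Parameters
  open ≤-Reasoning

  module Selection {n′ : ℕ} (G : BiGraph (suc n′)) (Q′ b e₀ r′ K P : ℕ) where

    open GraphCounts G
    open Constants Q′ b e₀
    open Sizes r′

    n N2 Bd : ℕ
    n  = suc n′
    N2 = n * n
    Bd = ∑² nonAdj

    ρ β : List (Fin n) → ℕ
    ρ = pairSum (colourEdge red)
    β = pairSum (colourEdge blue)

    nonDegree : Fin n → ℕ
    nonDegree x = ∑ (nonAdj x)

    N2≡2e+Bd : N2 ≡ 2 * e G + Bd
    N2≡2e+Bd = begin-equality
      N2                                                       ≡⟨ sym ∑²-red+blue+nonAdj ⟩
      ∑² (colourEdge red) + ∑² (colourEdge blue) + Bd          ≡⟨ cong (_+ Bd) (cong₂ _+_ (∑²-colourEdge red) (∑²-colourEdge blue)) ⟩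
      2 * eCol red G + 2 * eCol blue G + Bd                    ≡⟨ cong (_+ Bd) (sym (trans (cong (2 *_) e≡eRed+eBlue) (*-distribˡ-+ 2 (eCol red G) (eCol blue G)))) ⟩
      2 * e G + Bd                                             ∎

    ρ+β+defects≡C2 : ∀ xs → ρ xs + β xs + defects xs ≡ length xs C 2
    ρ+β+defects≡C2 xs = begin-equality
      ρ xs + β xs + defects xs
        ≡⟨ cong (_+ defects xs) (sym (pairSum-+ (colourEdge red) (colourEdge blue) xs)) ⟩
      pairSum (λ x y → colourEdge red x y + colourEdge blue x y) xs + defects xs
        ≡⟨ sym (pairSum-+ (λ x y → colourEdge red x y + colourEdge blue x y) nonAdj xs) ⟩
      pairSum (λ x y → colourEdge red x y + colourEdge blue x y + nonAdj x y) xs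
        ≡⟨ pairSum-cong red+blue+nonAdj≡1 xs ⟩
      pairSum (λ _ _ → 1) xs
        ≡⟨ pairSum-1 xs ⟩
      length xs C 2 ∎

    record BalancedClique : Set where
      field
        clique    : List (Fin n)
        isClique  : AllPairs Adj clique
        r≤length  : r ≤ length clique
        redShare  : b * (ρ clique + β clique) ≤ q * ρ clique
        blueShare : b * (ρ clique + β clique) ≤ q * β clique

    module _ (gap : b * Q + 1 ≤ q * P) (sparse : K * r * Bd ≤ 2 * N2)
             (K-large₁ : 8 * Q * q * (1 + c) * c ≤ K)
             (K-large₂ : 128 * (Q * Q) * (q * q) * ((1 + c) * (1 + c)) ≤ K)
             (K-large₃ : 8 * q * P ≤ K) where

      open Budget K P N2 Bd sparse K-large₁ K-large₂ K-large₃

      ordered-balance : ∀ c → P * e G ≤ Q * eCol c G → P * N2 ≤ Q * ∑² (colourEdge c) + P * Bd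
      ordered-balance c balanced = begin
        P * N2                               ≡⟨ cong (P *_) N2≡2e+Bd ⟩
        P * (2 * e G + Bd)                   ≡⟨ ring P (e G) Bd ⟩
        2 * (P * e G) + P * Bd               ≤⟨ +-monoˡ-≤ (P * Bd) (*-monoʳ-≤ 2 balanced) ⟩
        2 * (Q * eCol c G) + P * Bd          ≡⟨ cong (_+ P * Bd) (trans (sym (ring′ Q (eCol c G))) (cong (Q *_) (sym (∑²-colourEdge c)))) ⟩
        Q * ∑² (colourEdge c) + P * Bd       ∎
        where
        ring : ∀ P e B → P * (2 * e + B) ≡ 2 * (P * e) + P * B
        ring = solve-∀
        ring′ : ∀ Q x → Q * (2 * x) ≡ 2 * (Q * x)
        ring′ = solve-∀

      record HeavyTuple (c : Colour) (penalty : List (Fin n) → ℕ) : Set where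
        field
          tuple        : List (Fin n)
          length-tuple : length tuple ≡ m
          heavy        : b * T + a * m * Δ ≤ q * pairSum (colourEdge c) tuple
          few-defects  : 2 * defects tuple ≤ r
          low-penalty  : penalty tuple ≤ n * q * T

      -- the score  n q ρ_c - n (bT + amΔ) - n W₁ δ - penalty  is nonnegative on average
      heavyTuple : ∀ c → P * e G ≤ Q * eCol c G → (penalty : List (Fin n) → ℕ) (Z : ℕ) →
                   n * n * ∑Tuples m penalty ≡ (n ^ m * n) * Z → 4 * (Q * Z) ≤ T * N2 → HeavyTuple c penalty
      heavyTuple c balanced penalty Z ∑penalty quarter-Z = extract (∑Tuples-≤-witness m cost gain ∑cost≤∑gain)
        where
        ρc : List (Fin n) → ℕ
        ρc = pairSum (colourEdge c)
        gain cost : List (Fin n) → ℕ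
        gain xs = n * (q * ρc xs)
        cost xs = n * (b * T + a * m * Δ) + n * (W₁ * defects xs) + penalty xs
        Y : ℕ
        Y = a * m * Δ * N2 + W₁ * T * Bd + Z

        ∑gain : n * n * ∑Tuples m gain ≡ (n ^ m * n) * (q * T * ∑² (colourEdge c))
        ∑gain = begin-equality
          n * n * ∑Tuples m (λ xs → n * (q * ρc xs))  ≡⟨ cong (n * n *_) (trans (∑Tuples-* m n (λ xs → q * ρc xs)) (cong (n *_) (∑Tuples-* m q ρc))) ⟩
          n * n * (n * (q * ∑Tuples m ρc))            ≡⟨ ring₁ n q (∑Tuples m ρc) ⟩
          n * q * (n * n * ∑Tuples m ρc)              ≡⟨ cong (n * q *_) (∑Tuples-pairSum m (colourEdge c)) ⟩
          n * q * (T * n ^ m * ∑² (colourEdge c))     ≡⟨ ring₂ n q T (n ^ m) (∑² (colourEdge c)) ⟩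
          (n ^ m * n) * (q * T * ∑² (colourEdge c))   ∎
          where
          ring₁ : ∀ n q X → n * n * (n * (q * X)) ≡ n * q * (n * n * X)
          ring₁ = solve-∀
          ring₂ : ∀ n q T N R → n * q * (T * N * R) ≡ N * n * (q * T * R)
          ring₂ = solve-∀

        ∑cost : n * n * ∑Tuples m cost ≡ (n ^ m * n) * (b * T * N2 + Y)
        ∑cost = begin-equality
          n * n * ∑Tuples m cost
            ≡⟨ cong (n * n *_) split ⟩
          n * n * (n * A * n ^ m + n * (W₁ * ∑Tuples m defects) + ∑Tuples m penalty)
            ≡⟨ ring₁ n A (n ^ m) W₁ (∑Tuples m defects) (∑Tuples m penalty) ⟩
          n ^ m * n * A * (n * n) + n * W₁ * (n * n * ∑Tuples m defects) + n * n * ∑Tuples m penalty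
            ≡⟨ cong₂ (λ x y → n ^ m * n * A * (n * n) + n * W₁ * x + y) (∑Tuples-pairSum m nonAdj) ∑penalty ⟩
          n ^ m * n * A * (n * n) + n * W₁ * (T * n ^ m * Bd) + n ^ m * n * Z
            ≡⟨ ring₂ n (n ^ m) b T (a * m * Δ) W₁ Bd Z ⟩
          (n ^ m * n) * (b * T * N2 + Y) ∎
          where
          A : ℕ
          A = b * T + a * m * Δ
          split : ∑Tuples m cost ≡ n * A * n ^ m + n * (W₁ * ∑Tuples m defects) + ∑Tuples m penalty
          split = begin-equality
            ∑Tuples m cost
              ≡⟨ ∑Tuples-+ m (λ xs → n * A + n * (W₁ * defects xs)) penalty ⟩
            ∑Tuples m (λ xs → n * A + n * (W₁ * defects xs)) + ∑Tuples m penalty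
              ≡⟨ cong (_+ ∑Tuples m penalty) (∑Tuples-+ m (λ _ → n * A) (λ xs → n * (W₁ * defects xs))) ⟩
            ∑Tuples m (λ _ → n * A) + ∑Tuples m (λ xs → n * (W₁ * defects xs)) + ∑Tuples m penalty
              ≡⟨ cong₂ (λ x y → x + y + ∑Tuples m penalty) (∑Tuples-const m (n * A))
                       (trans (∑Tuples-* m n (λ xs → W₁ * defects xs)) (cong (n *_) (∑Tuples-* m W₁ defects))) ⟩
            n * A * n ^ m + n * (W₁ * ∑Tuples m defects) + ∑Tuples m penalty ∎
          ring₁ : ∀ n A N W X Y → n * n * (n * A * N + n * (W * X) + Y) ≡ N * n * A * (n * n) + n * W * (n * n * X) + n * n * Y
          ring₁ = solve-∀
          ring₂ : ∀ n N b T A W B Z → N * n * (b * T + A) * (n * n) + n * W * (T * N * B) + N * n * Z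
                                      ≡ N * n * (b * T * (n * n) + (A * (n * n) + W * T * B + Z))
          ring₂ = solve-∀

        ∑cost≤∑gain : ∑Tuples m cost ≤ ∑Tuples m gain
        ∑cost≤∑gain = *-cancelˡ-≤ (n * n) (begin
          n * n * ∑Tuples m cost                      ≡⟨ ∑cost ⟩
          (n ^ m * n) * (b * T * N2 + Y)              ≤⟨ *-monoʳ-≤ (n ^ m * n) (heavy-on-average P Q′ b q T N2 (∑² (colourEdge c)) Bd Y
                                                           (ordered-balance c balanced) gap (within-budget Z quarter-Z)) ⟩
          (n ^ m * n) * (q * T * ∑² (colourEdge c))   ≡⟨ sym ∑gain ⟩
          n * n * ∑Tuples m gain                      ∎)

        extract : Σ (List (Fin n)) (λ xs → length xs ≡ m × cost xs ≤ gain xs) → HeavyTuple c penalty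
        extract (xs , |xs|≡m , cost≤gain) = record
          { tuple        = xs
          ; length-tuple = |xs|≡m
          ; heavy        = *-cancelˡ-≤ n (≤-trans (m≤m+n _ _) (≤-trans (m≤m+n _ _) cost≤gain))
          ; few-defects  = W₁-small⇒ (defects xs) (*-cancelˡ-≤ n (subst (n * (W₁ * defects xs) ≤_) (*-assoc n q T)
                             (≤-trans (m≤n+m _ (n * (b * T + a * m * Δ))) (≤-trans (m≤m+n _ (penalty xs)) (≤-trans cost≤gain gain≤nqT)))))
          ; low-penalty  = ≤-trans (m≤n+m _ _) (≤-trans cost≤gain gain≤nqT)
          }
          where
          gain≤nqT : gain xs ≤ n * q * T
          gain≤nqT = subst (gain xs ≤_) (sym (*-assoc n q T))
            (*-monoʳ-≤ n (*-monoʳ-≤ q (subst (λ l → ρc xs ≤ l C 2) |xs|≡m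
              (pairSum-≤-C2 (colourEdge c) (λ x y → indicator≤1 _) xs))))

      module _ (balR : P * e G ≤ Q * eCol red G) (balB : P * e G ≤ Q * eCol blue G) where

        first : HeavyTuple red (λ xs → W₂ * sumMap nonDegree xs)
        first = heavyTuple red balR (λ xs → W₂ * sumMap nonDegree xs) (W₂ * m * Bd) ∑penalty quarter-W₂
          where
          ∑penalty : n * n * ∑Tuples m (λ xs → W₂ * sumMap nonDegree xs) ≡ (n ^ m * n) * (W₂ * m * Bd)
          ∑penalty = begin-equality
            n * n * ∑Tuples m (λ xs → W₂ * sumMap nonDegree xs) ≡⟨ cong (n * n *_) (∑Tuples-* m W₂ (sumMap nonDegree)) ⟩
            n * n * (W₂ * ∑Tuples m (sumMap nonDegree))          ≡⟨ ring₁ n W₂ (∑Tuples m (sumMap nonDegree)) ⟩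
            n * W₂ * (n * ∑Tuples m (sumMap nonDegree))          ≡⟨ cong (n * W₂ *_) (∑Tuples-sumMap m nonDegree) ⟩
            n * W₂ * (m * n ^ m * Bd)                            ≡⟨ ring₂ n W₂ m (n ^ m) Bd ⟩
            (n ^ m * n) * (W₂ * m * Bd)                          ∎
            where
            ring₁ : ∀ n W X → n * n * (W * X) ≡ n * W * (n * X)
            ring₁ = solve-∀
            ring₂ : ∀ n W m N B → n * W * (m * N * B) ≡ N * n * (W * m * B)
            ring₂ = solve-∀

        open HeavyTuple first using () renaming (tuple to u; length-tuple to |u|≡m; heavy to u-heavy; few-defects to u-few-defects; low-penalty to u-low-penalty)

        cross : List (Fin n) → ℕ
        cross = crossSum nonAdj u

        second : HeavyTuple blue (λ xs → n * W₁ * cross xs)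
        second = heavyTuple blue balB (λ xs → n * W₁ * cross xs) (W₁ * n * m * sumMap nonDegree u) ∑penalty
                            (quarter-cross n (sumMap nonDegree u) u-low-penalty)
          where
          ∑cross : n * ∑Tuples m cross ≡ m * n ^ m * sumMap nonDegree u
          ∑cross = begin-equality
            n * ∑Tuples m cross                                             ≡⟨ cong (n *_) (∑Tuples-cong m (sumMap-swap nonAdj u)) ⟩
            n * ∑Tuples m (sumMap (λ y → sumMap (λ x → nonAdj x y) u))      ≡⟨ ∑Tuples-sumMap m (λ y → sumMap (λ x → nonAdj x y) u) ⟩
            m * n ^ m * ∑ (λ y → sumMap (λ x → nonAdj x y) u)               ≡⟨ cong (m * n ^ m *_) (∑-sumMap-swap (λ y x → nonAdj x y) u) ⟩
            m * n ^ m * sumMap nonDegree u                                  ∎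
          ∑penalty : n * n * ∑Tuples m (λ xs → n * W₁ * cross xs) ≡ (n ^ m * n) * (W₁ * n * m * sumMap nonDegree u)
          ∑penalty = begin-equality
            n * n * ∑Tuples m (λ xs → n * W₁ * cross xs) ≡⟨ cong (n * n *_) (∑Tuples-* m (n * W₁) cross) ⟩
            n * n * (n * W₁ * ∑Tuples m cross)           ≡⟨ ring₁ n W₁ (∑Tuples m cross) ⟩
            n * n * W₁ * (n * ∑Tuples m cross)           ≡⟨ cong (n * n * W₁ *_) ∑cross ⟩
            n * n * W₁ * (m * n ^ m * sumMap nonDegree u) ≡⟨ ring₂ n W₁ m (n ^ m) (sumMap nonDegree u) ⟩
            (n ^ m * n) * (W₁ * n * m * sumMap nonDegree u) ∎
            where
            ring₁ : ∀ n W X → n * n * (n * W * X) ≡ n * n * W * (n * X)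
            ring₁ = solve-∀
            ring₂ : ∀ n W m N D → n * n * W * (m * N * D) ≡ N * n * (W * n * m * D)
            ring₂ = solve-∀

        open HeavyTuple second using () renaming (tuple to v; length-tuple to |v|≡m; heavy to v-heavy; few-defects to v-few-defects; low-penalty to v-low-penalty)

        few-cross : 2 * cross v ≤ r
        few-cross = W₁-small⇒ (cross v) (*-cancelˡ-≤ n (subst₂ _≤_ (*-assoc n W₁ (cross v)) (*-assoc n q T) v-low-penalty))

        |u|≡|v| : length u ≡ length v
        |u|≡|v| = trans |u|≡m (sym |v|≡m)

        hybrids : ℕ → List (Fin n)
        hybrids k = hybrid k u v

        length-hybrids : ∀ k → length (hybrids k) ≡ m
        length-hybrids k = trans (length-hybrid k u v) |u|≡m

        defects-hybrids : ∀ k → defects (hybrids k) ≤ Δ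
        defects-hybrids k = *-cancelˡ-≤ 2 (begin
          2 * defects (hybrids k)
            ≤⟨ *-monoʳ-≤ 2 (pairSum-hybrid-≤ nonAdj k u v) ⟩
          2 * (defects u + defects v + cross v + crossSum nonAdj v u)
            ≡⟨ cong (λ z → 2 * (defects u + defects v + cross v + z)) (crossSum-sym nonAdj nonAdj-sym u v) ⟩
          2 * (defects u + defects v + cross v + cross v)
            ≡⟨ ring (defects u) (defects v) (cross v) ⟩
          2 * defects u + 2 * defects v + 2 * cross v + 2 * cross v
            ≤⟨ +-mono-≤ (+-mono-≤ (+-mono-≤ u-few-defects v-few-defects) few-cross) few-cross ⟩
          r + r + r + r
            ≡⟨ ring′ r ⟩
          2 * Δ ∎)
          where
          ring : ∀ x y z → 2 * (x + y + z + z) ≡ 2 * x + 2 * y + 2 * z + 2 * z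
          ring = solve-∀
          ring′ : ∀ r → r + r + r + r ≡ 2 * (2 * r)
          ring′ = solve-∀

        ρ+β+defects≡T : ∀ xs → length xs ≡ m → ρ xs + β xs + defects xs ≡ T
        ρ+β+defects≡T xs |xs|≡m = trans (ρ+β+defects≡C2 xs) (cong (_C 2) |xs|≡m)

        endpoint : ∀ x y z → x + y + z ≡ T → b * T + a * m * Δ ≤ q * x → b * y + a * m * Δ ≤ a * x
        endpoint x y z x+y+z≡T heavy = +-cancelˡ-≤ (b * x) _ _ (begin
          b * x + (b * y + a * m * Δ)  ≡⟨ ring b x y (a * m * Δ) ⟩
          b * (x + y) + a * m * Δ      ≤⟨ +-monoˡ-≤ (a * m * Δ) (*-monoʳ-≤ b (subst (x + y ≤_) x+y+z≡T (m≤m+n (x + y) z))) ⟩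
          b * T + a * m * Δ            ≤⟨ heavy ⟩
          (b + a) * x                  ≡⟨ *-distribʳ-+ x b a ⟩
          b * x + a * x                ∎)
          where
          ring : ∀ b x y A → b * x + (b * y + A) ≡ b * (x + y) + A
          ring = solve-∀

        ρₖ βₖ : ℕ → ℕ
        ρₖ k = ρ (hybrids k)
        βₖ k = β (hybrids k)

        ρ-step : ∀ k → k < m → ρₖ k ≤ ρₖ (suc k) + m
        ρ-step k _ = subst (λ l → ρₖ k ≤ ρₖ (suc k) + l) (length-hybrids (suc k))
                           (pairSum-Differ₁ (colourEdge red) (λ x y → indicator≤1 _) (hybrid-step k u v))

        β-step : ∀ k → k < m → βₖ (suc k) ≤ βₖ k + m
        β-step k _ = subst (λ l → βₖ (suc k) ≤ βₖ k + l) (length-hybrids k)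
                           (pairSum-Differ₁ (colourEdge blue) (λ x y → indicator≤1 _) (Differ₁-sym (hybrid-step k u v)))

        ρ+β-large : ∀ k → k ≤ m → T ≤ ρₖ k + βₖ k + Δ
        ρ+β-large k _ = subst (_≤ ρₖ k + βₖ k + Δ) (ρ+β+defects≡T (hybrids k) (length-hybrids k))
                              (+-monoʳ-≤ (ρₖ k + βₖ k) (defects-hybrids k))

        open Crossing b e₀ m Δ T m ρₖ βₖ ρ-step β-step ρ+β-large T-large using (balanced-point)

        red-heavy-start : b * βₖ 0 + a * m * Δ ≤ a * ρₖ 0
        red-heavy-start = endpoint (ρ u) (β u) (defects u) (ρ+β+defects≡T u |u|≡m) u-heavy

        blue-heavy-end : b * ρₖ m + a * m * Δ ≤ a * βₖ m
        blue-heavy-end = subst (λ w → b * ρ w + a * m * Δ ≤ a * β w) (sym v≡hybrids-m)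
          (endpoint (β v) (ρ v) (defects v) (trans (cong (_+ defects v) (+-comm (β v) (ρ v))) (ρ+β+defects≡T v |v|≡m)) v-heavy)
          where
          v≡hybrids-m : hybrids m ≡ v
          v≡hybrids-m = trans (cong (λ k → hybrid k u v) (sym |u|≡m)) (hybrid-length u v |u|≡|v|)

        -- removing the ≤ m Δ pairs lost to cleaning keeps both colours above a b/q share
        share-kept : ∀ x y x′ y′ → b * y + a * m * Δ ≤ a * x → x ≤ x′ + m * Δ → y′ ≤ y → b * (x′ + y′) ≤ q * x′
        share-kept x y x′ y′ heavy x≤x′+mΔ y′≤y = begin
          b * (x′ + y′)     ≡⟨ *-distribˡ-+ b x′ y′ ⟩
          b * x′ + b * y′   ≤⟨ +-monoʳ-≤ (b * x′) (≤-trans (*-monoʳ-≤ b y′≤y) by≤ax′) ⟩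
          b * x′ + a * x′   ≡⟨ sym (*-distribʳ-+ x′ b a) ⟩
          q * x′            ∎
          where
          by≤ax′ : b * y ≤ a * x′
          by≤ax′ = +-cancelʳ-≤ (a * m * Δ) _ _ (begin
            b * y + a * m * Δ      ≤⟨ heavy ⟩
            a * x                  ≤⟨ *-monoʳ-≤ a x≤x′+mΔ ⟩
            a * (x′ + m * Δ)       ≡⟨ *-distribˡ-+ a x′ (m * Δ) ⟩
            a * x′ + a * (m * Δ)   ≡⟨ cong (a * x′ +_) (sym (*-assoc a m Δ)) ⟩
            a * x′ + a * m * Δ     ∎)

        cleaned : Σ ℕ (λ k → b * βₖ k + a * m * Δ ≤ a * ρₖ k × b * ρₖ k + a * m * Δ ≤ a * βₖ k) → BalancedClique
        cleaned (k , red-heavy , blue-heavy) = record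
          { clique    = ks
          ; isClique  = greedyClique-clique xs
          ; r≤length  = +-cancelʳ-≤ Δ _ _ (≤-trans r+Δ≤m (subst (_≤ length ks + Δ) (length-hybrids k)
                          (≤-trans (length-≤-greedyClique xs) (+-monoʳ-≤ (length ks) (defects-hybrids k)))))
          ; redShare  = share-kept (ρ xs) (β xs) (ρ ks) (β ks) red-heavy (loss red) (pairSum-greedyClique-≤ (colourEdge blue) xs)
          ; blueShare = subst (_≤ q * β ks) (cong (b *_) (+-comm (β ks) (ρ ks)))
                          (share-kept (β xs) (ρ xs) (β ks) (ρ ks) blue-heavy (loss blue) (pairSum-greedyClique-≤ (colourEdge red) xs))
          }
          where
          xs ks : List (Fin n)
          xs = hybrids k
          ks = greedyClique xs
          loss : ∀ c → pairSum (colourEdge c) xs ≤ pairSum (colourEdge c) ks + m * Δ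
          loss c = ≤-trans (pairSum-≤-greedyClique (colourEdge c) (λ x y → indicator≤1 _) xs)
                           (+-monoʳ-≤ (pairSum (colourEdge c) ks)
                                      (subst (λ l → l * defects xs ≤ m * Δ) (sym (length-hybrids k)) (*-monoʳ-≤ m (defects-hybrids k))))

        balancedClique : BalancedClique
        balancedClique = cleaned (balanced-point red-heavy-start blue-heavy-end)

module Assembly where

  open import Defs
  open import Data.Nat using (ℕ; zero; suc; _+_; _*_; _≤_; _<_; s≤s; z≤n; NonZero)
  open import Data.Nat.Properties
  open import Data.Nat.Combinatorics using (_C_)
  open import Data.Fin using (Fin)
  open import Data.List using (length; allFin)
  open import Data.Integer using (+_)
  open import Data.Rational using (ℚ; mkℚ; ½; 0ℚ) renaming (_≤_ to _≤ℚ_; _<_ to _<ℚ_)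
  open import Data.Nat.Coprimality using (Coprime)
  open import Data.Product using (Σ; _×_; _,_; proj₁; proj₂)
  open import Relation.Binary.PropositionalEquality
  open import Data.Empty using (⊥; ⊥-elim)
  open import Data.Nat.Tactic.RingSolver using (solve-∀)
  open FiniteSums
  open TupleSums
  open ColourCounts
  open Fractions
  open Parameters
  open CliqueSelection
  open ≤-Reasoning

  module LargeK (Q′ b e₀ P : ℕ) where

    open Constants Q′ b e₀ using (Q; q; c; q-nonZero)

    Z₀ Z : ℕ
    Z₀ = Q * q * (1 + c)
    Z  = Z₀ * (1 + P)

    -- opaque, so that conversion checking never unfolds the large polynomial K
    opaque
      K : ℕ
      K = suc (128 * (Z * Z))

      K-nonZero : NonZero K
      K-nonZero = _

      0<K*[1+r] : ∀ r → 0 < K * suc r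
      0<K*[1+r] r = s≤s z≤n

      128Z²≤K : 128 * (Z * Z) ≤ K
      128Z²≤K = n≤1+n _

    private
      128Z₀²≤K : 128 * (Z₀ * Z₀) ≤ K
      128Z₀²≤K = ≤-trans (*-monoʳ-≤ 128 (*-mono-≤ Z₀≤Z Z₀≤Z)) 128Z²≤K
        where
        Z₀≤Z : Z₀ ≤ Z
        Z₀≤Z = m≤m*n Z₀ (1 + P)

    K-large₁ : 8 * Q * q * (1 + c) * c ≤ K
    K-large₁ = begin
      8 * Q * q * (1 + c) * c      ≡⟨ ring Q q c ⟩
      8 * (Z₀ * c)                 ≤⟨ *-monoʳ-≤ 8 (*-monoʳ-≤ Z₀ c≤Z₀) ⟩
      8 * (Z₀ * Z₀)                ≤⟨ *-monoˡ-≤ (Z₀ * Z₀) (m≤m+n 8 120) ⟩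
      128 * (Z₀ * Z₀)              ≤⟨ 128Z₀²≤K ⟩
      K                            ∎
      where
      c≤Z₀ : c ≤ Z₀
      c≤Z₀ = ≤-trans (n≤1+n c) (m≤n*m (1 + c) (Q * q) {{m*n≢0 Q q}})
      ring : ∀ Q q c → 8 * Q * q * (1 + c) * c ≡ 8 * (Q * q * (1 + c) * c)
      ring = solve-∀

    K-large₂ : 128 * (Q * Q) * (q * q) * ((1 + c) * (1 + c)) ≤ K
    K-large₂ = subst (_≤ K) (ring Q q (1 + c)) 128Z₀²≤K
      where
      ring : ∀ Q q x → 128 * ((Q * q * x) * (Q * q * x)) ≡ 128 * (Q * Q) * (q * q) * (x * x)
      ring = solve-∀

    K-large₃ : 8 * q * P ≤ K
    K-large₃ = begin
      8 * q * P          ≤⟨ *-monoʳ-≤ (8 * q) (n≤1+n P) ⟩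
      8 * q * (1 + P)    ≤⟨ *-monoˡ-≤ (1 + P) (*-monoʳ-≤ 8 q≤Z₀) ⟩
      8 * Z₀ * (1 + P)   ≡⟨ *-assoc 8 Z₀ (1 + P) ⟩
      8 * Z              ≤⟨ *-monoʳ-≤ 8 (m≤m*n Z Z {{m*n≢0 Z₀ (1 + P) {{m*n≢0 (Q * q) (1 + c) {{m*n≢0 Q q}}}}}}) ⟩
      8 * (Z * Z)        ≤⟨ *-monoˡ-≤ (Z * Z) (m≤m+n 8 120) ⟩
      128 * (Z * Z)      ≤⟨ 128Z²≤K ⟩
      K                  ∎
      where
      q≤Z₀ : q ≤ Z₀
      q≤Z₀ = ≤-trans (m≤n*m q Q) (m≤m*n (Q * q) (1 + c))

  sparse-from-threshold : ∀ {n} (G : BiGraph n) X → X ≤ n → X * (n C 2) ≤ X * e G + n C 2 →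
                          X * ∑² (GraphCounts.nonAdj G) ≤ 2 * (n * n)
  sparse-from-threshold {n} G X X≤n dense = begin
    X * ∑² nonAdj                           ≡⟨ cong (X *_) ∑²-nonAdj ⟩
    X * (2 * M + n)                         ≡⟨ ring X M n ⟩
    2 * (X * M) + X * n                     ≤⟨ +-mono-≤ (*-monoʳ-≤ 2 XM≤C2) (*-monoˡ-≤ n X≤n) ⟩
    2 * (n C 2) + n * n                     ≤⟨ +-monoˡ-≤ (n * n) (2*nC2≤n*n n) ⟩
    n * n + n * n                           ≡⟨ ring′ (n * n) ⟩
    2 * (n * n)                             ∎
    where
    open GraphCounts G
    M : ℕ
    M = defects (allFin n)
    ring : ∀ X M n → X * (2 * M + n) ≡ 2 * (X * M) + X * n
    ring = solve-∀
    ring′ : ∀ y → y + y ≡ 2 * y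
    ring′ = solve-∀
    XM≤C2 : X * M ≤ n C 2
    XM≤C2 = +-cancelˡ-≤ (X * e G) _ _ (begin
      X * e G + X * M      ≡⟨ sym (*-distribˡ-+ X (e G) M) ⟩
      X * (e G + M)        ≡⟨ cong (X *_) e+defects≡C2 ⟩
      X * (n C 2)          ≤⟨ dense ⟩
      X * e G + n C 2      ∎)

  emptyGraph : BiGraph 0
  emptyGraph = record { col = λ () ; symm = λ () ; irrefl = λ () }

  -- the empty graph is ε′-balanced, so it must be excluded by R(ε′, t) for t ≥ 1
  R-positive : ∀ ε′ t R → IsR ε′ (suc t) R → ε′ Data.Rational.* toℚ 0 ≤ℚ toℚ 0 → 1 ≤ R
  R-positive ε′ t zero    (R-works , _) 0-balanced = ⊥-elim (no-vertex (embedding Fin.zero))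
    where
    import Data.Fin as Fin
    embedding : Fin (suc t + suc t) → Fin 0
    embedding = proj₁ (proj₂ (proj₂ (R-works 0 z≤n emptyGraph (λ ()) (0-balanced , 0-balanced))))
    no-vertex : Fin 0 → ⊥
    no-vertex ()
  R-positive ε′ t (suc R) _ _ = s≤s z≤n

  module Unavoidable (P₀ d p₀ d′ : ℕ) .(c : Coprime (suc P₀) (suc d)) .(c′ : Coprime (suc p₀) (suc d′))
                     (ε≤½ : mkℚ (+ suc P₀) d c ≤ℚ ½) (ε′<ε : mkℚ (+ suc p₀) d′ c′ <ℚ mkℚ (+ suc P₀) d c) where

    P Q b q′ : ℕ
    P  = suc P₀
    Q  = suc d
    b  = suc p₀
    q′ = suc d′

    ε ε′ : ℚ
    ε  = mkℚ (+ P) d c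
    ε′ = mkℚ (+ b) d′ c′

    2b<q′ : 2 * b < q′
    2b<q′ = *-cancelʳ-< Q (2 * b) q′ (begin-strict
      2 * b * Q    ≡⟨ *-assoc 2 b Q ⟩
      2 * (b * Q)  <⟨ *-monoʳ-< 2 (fraction-<⇒ b d′ P d c′ c ε′<ε) ⟩
      2 * (P * q′) ≡⟨ sym (*-assoc 2 P q′) ⟩
      2 * P * q′   ≤⟨ *-monoˡ-≤ q′ (fraction-≤½⇒ P d c ε≤½) ⟩
      Q * q′       ≡⟨ *-comm Q q′ ⟩
      q′ * Q       ∎)

    -- ε′ = b / (b + a) with a = b + 1 + e₀ > b
    e₀ : ℕ
    e₀ = proj₁ (m≤n⇒∃[o]m+o≡n 2b<q′)

    b+a≡q′ : b + (b + suc e₀) ≡ q′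
    b+a≡q′ = trans (ring b e₀) (proj₂ (m≤n⇒∃[o]m+o≡n 2b<q′))
      where
      ring : ∀ b e → b + (b + suc e) ≡ suc (2 * b) + e
      ring = solve-∀

    gap : b * Q + 1 ≤ (b + (b + suc e₀)) * P
    gap = subst₂ _≤_ (+-comm 1 (b * Q)) (trans (*-comm P q′) (cong (_* P) (sym b+a≡q′))) (fraction-<⇒ b d′ P d c′ c ε′<ε)

    open LargeK d b e₀ P public using (K; K-nonZero; 0<K*[1+r]; K-large₁; K-large₂; K-large₃)

    contains-unavoidable : ∀ t R → IsR ε′ t R →
      Σ ℕ λ N → ∀ n → N ≤ n → (G : BiGraph n) → Balanced ε G → threshold (toℚ K) R n ≤ℚ toℚ (e G) →
                ContainsUnavoidable t G
    contains-unavoidable zero    R        _   = 0 , λ _ _ _ _ _ → type1 , red , (λ ()) , (λ { {()} }) , (λ ())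
    contains-unavoidable (suc t) zero     isR =
      ⊥-elim (1+n≰n (R-positive ε′ t zero isR (fraction*toℚ-≤⇐ b d′ c′ 0 0 (≤-reflexive (trans (*-zeroʳ b) (sym (*-zeroʳ q′)))))))
    contains-unavoidable (suc t) (suc r′) isR = K * suc r′ , large
      where
      large : ∀ n → K * suc r′ ≤ n → (G : BiGraph n) → Balanced ε G → threshold (toℚ K) (suc r′) n ≤ℚ toℚ (e G) →
              ContainsUnavoidable (suc t) G
      large zero    Kr≤0 _ _ _ = ⊥-elim (<⇒≱ (0<K*[1+r] r′) Kr≤0)
      large (suc n′) Kr≤n G (balR , balB) dense =
        transfer (proj₁ isR (length clique) r≤length H (induced-complete isClique) (shareH red redShare , shareH blue blueShare))
        where
        open GraphCounts G
        open Selection G d b e₀ r′ K P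
        sparse : K * suc r′ * ∑² nonAdj ≤ 2 * (suc n′ * suc n′)
        sparse = sparse-from-threshold G (K * suc r′) Kr≤n (threshold-≤⇒ K r′ (suc n′) (e G) {{K-nonZero}} dense)
        open BalancedClique (balancedClique gap sparse K-large₁ K-large₂ K-large₃
                               (fraction*toℚ-≤⇒ P d c (e G) (eCol red G) balR)
                               (fraction*toℚ-≤⇒ P d c (e G) (eCol blue G) balB))
        open Induced G clique
        H : BiGraph (length clique)
        H = induced G clique
        shareH : ∀ col → b * (ρ clique + β clique) ≤ (b + (b + suc e₀)) * pairSum (colourEdge col) clique →
                 ε′ Data.Rational.* toℚ (e H) ≤ℚ toℚ (eCol col H)
        shareH col share = fraction*toℚ-≤⇐ b d′ c′ (e H) (eCol col H)
          (subst₂ _≤_ (cong (b *_) (sym e-induced)) (cong₂ _*_ b+a≡q′ (sym (eCol-induced col))) share)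
        transfer : ContainsUnavoidable (suc t) H → ContainsUnavoidable (suc t) G
        transfer (τ , colour , copy) = τ , colour , induced-contains isClique _ copy

  UnavoidableBound : ℚ → ℚ → Set
  UnavoidableBound ε ε′ =
    Σ ℚ λ K → 0ℚ <ℚ K ×
      ((t : ℕ) → (R : ℕ) → IsR ε′ t R →
        Σ ℕ λ N → (n : ℕ) → N ≤ n → (G : BiGraph n) →
          Balanced ε G → threshold K R n ≤ℚ toℚ (e G) → ContainsUnavoidable t G)

  unavoidableBound : ∀ {ε ε′} → PositiveFraction ε → PositiveFraction ε′ → ε ≤ℚ ½ → ε′ <ℚ ε → UnavoidableBound ε ε′
  unavoidableBound (fraction P₀ d c) (fraction p₀ d′ c′) ε≤½ ε′<ε = toℚ K , toℚ-positive K {{K-nonZero}} , contains-unavoidable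
    where open Unavoidable P₀ d p₀ d′ c c′ ε≤½ ε′<ε

open import Defs
open import Data.Nat using (ℕ) renaming (_≤_ to _≤ℕ_)
open import Data.Rational using (ℚ; 0ℚ; ½; _<_; _≤_)
open import Data.Product using (Σ; _×_)
open Fractions using (positiveFraction)
open Assembly using (unavoidableBound)

theorem1p1 : (ε : ℚ) → 0ℚ < ε → ε ≤ ½ →
    (ε' : ℚ) → 0ℚ < ε' → ε' < ε →
    Σ ℚ λ K → 0ℚ < K ×
    ((t : ℕ) → (R : ℕ) → IsR ε' t R →
    Σ ℕ λ N → (n : ℕ) → N ≤ℕ n → (G : BiGraph n) →
    Balanced ε G → threshold K R n ≤ toℚ (e G) →
    ContainsUnavoidable t G)
theorem1p1 ε 0<ε ε≤½ ε′ 0<ε′ ε′<ε =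
  unavoidableBound (positiveFraction ε 0<ε) (positiveFraction ε′ 0<ε′) ε≤½ ε′<ε
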